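{- Let $N=(\mathscr S,\mathscr C,\mathscr R)$ be a 0,1-network with reactions $y_1\to y_1',\dots,y_m\to y_m'$, and suppose the vertex $u_i$ of the network hypergraph $\mathcal H_N$ is almost balanced with respect to a 2-colored multiset $\mathscr E=\mathscr E_r\sqcup\mathscr E_b$ over the edges of $\mathcal H_N$. Let $s_k$ be a species (not necessarily in $\mathscr S$) with $s_k\notin\mathrm{supp}(y_i')$, and let $N'=(N\setminus\{y_i\to y_i'\})\cup\{y_i\to y_i'+s_k\}$, i.e. $N'$ is obtained from $N$ by replacing the $i$-th reaction (rate constant $\kappa_i$) by the reaction $y_i\to y_i'+s_k$ with a new rate constant $\kappa_i'$. If the species hyperedge $E_{s_k}$ does not belong to $\mathscr E$, then $\mathcal I(N')=\mathcal I(N)$.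
   Context: A chemical reaction network $N=(\mathscr S,\mathscr C,\mathscr R)$ consists of a finite set of species $\mathscr S$, a finite set of complexes $\mathscr C\subseteq\mathbb Z_{\ge0}^{\mathscr S}$, and a finite set of reactions $\mathscr R$, each written $y\to y'$ with $y,y'\in\mathscr C$, $y\ne y'$; every complex occurs in some reaction, every species lies in the support of some complex, and there are no reactions of the form $\varnothing\to y$ (the zero complex $\varnothing$ may occur only as a product). Reactions are indexed $1,\dots,m$, the $i$-th written $y_i\to y_i'$ with rate constant $\kappa_i$. $N$ is a 0,1-network if every complex lies in $\{0,1\}^{\mathscr S}$. For a complex $y$, $x^y=\prod_{s}x_s^{y_s}$. The steady-state polynomial of species $s$ is $\dot x_s=\sum_{i}\kappa_i x^{y_i}(y'_{i,s}-y_{i,s})\in\mathbb K(\kappa)[x]$, where the $\kappa_i$ are indeterminates and $\mathbb K$ is a field of characteristic zero (the paper uses $\mathbb Q$); the steady-state ideal is $\mathcal I(N)=\langle \dot x_s : s\in\mathscr S\rangle$. When $N'$ is obtained from $N$ by modifying a reaction, $\mathcal I(N)$ and $\mathcal I(N')$ are compared as ideals of the common larger ring $\mathbb K(\kappa_1,\dots,\kappa_m,\kappa_i')[x_s : s\in\mathscr S\cup\mathscr S']$. The network hypergraph $\mathcal H_N$ has $2m$ vertices $u_1,v_1,\dots,u_m,v_m$ ($u_i$ represents the reactant $y_i$ of the $i$-th reaction and $v_i$ its product $y_i'$). Its hyperedges are: for each species $s$, the species hyperedge $E_s=\{u_i: s\in\mathrm{supp}(y_i)\}\cup\{v_i: s\in\mathrm{supp}(y_i')\}$;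 and for each reaction $i$, the reaction hyperedge $E_i=\{u_i,v_i\}$ if $y_i'\ne\varnothing$, and $E_i=\varnothing$ if $y_i'=\varnothing$. A multiset $\mathscr E$ over the edges assigns a nonnegative multiplicity to each edge; an edge belongs to $\mathscr E$ if its multiplicity is positive. A 2-coloring $\mathscr E=\mathscr E_r\sqcup\mathscr E_b$ splits $\mathscr E$ into two submultisets (red and blue) whose multiplicities add to those of $\mathscr E$. For a vertex $w$ and $c\in\{r,b\}$, $\deg_{\mathscr E_c}(w)$ is the number of edges of $\mathscr E_c$, counted with multiplicity, containing $w$. A vertex $w$ is almost balanced with respect to the 2-coloring if $\deg_{\mathscr E_r}(w)=\deg_{\mathscr E_b}(w)+k$ for some positive integer $k$, and $\deg_{\mathscr E_r}(z)=\deg_{\mathscr E_b}(z)$ for every other vertex $z$. -}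

module Defs where

open import Level using (Level; _⊔_)
open import Data.Bool using (Bool; true; false; if_then_else_)
open import Data.Nat as ℕ using (ℕ; zero; suc; _<_; _≤_)
open import Data.Fin as Fin using (Fin; _↑ˡ_; _↑ʳ_; inject₁; fromℕ)
open import Data.Fin.Properties using (any?)
import Data.Fin.Properties as FinP
open import Data.Vec as Vec using (Vec; lookup; tabulate; replicate; _++_; zipWith)
import Data.Vec.Properties as VecP
import Data.Nat.Properties as ℕP
open import Data.List as List using (List; []; _∷_; map; concatMap; allFin; filter; length)
open import Data.List.Relation.Unary.All using (All)
open import Data.Product using (Σ; ∃; _×_; _,_; proj₁; proj₂)
open import Data.Sum using (_⊎_)
open import Relation.Nullary using (¬_; Dec; yes; no; does)
open import Relation.Nullary.Decidable using (_⊎-dec_; ¬?)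
open import Relation.Binary.PropositionalEquality using (_≡_; _≢_)
open import Algebra.Bundles using (CommutativeRing)
open import Data.Nat.ListAction using () renaming (sum to sumℕ)

module FieldDefs {c ℓ : Level} (K : CommutativeRing c ℓ) where
  open CommutativeRing K

  natK : ℕ → Carrier
  natK zero    = 0#
  natK (suc n) = 1# + natK n

  record IsFieldChar0 : Set (c ⊔ ℓ) where
    field
      one≉zero : ¬ (1# ≈ 0#)
      inverse  : ∀ x → ¬ (x ≈ 0#) → ∃ λ y → (x * y) ≈ 1#
      char0    : ∀ n → ¬ (natK (suc n) ≈ 0#)

-- Multivariate polynomials over K in variables Fin v, represented as
-- formal finite sums of terms (coefficient , exponent vector), with
-- equality meaning: equal coefficient at every monomial.

module PolyDefs {c ℓ : Level} (K : CommutativeRing c ℓ) where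
  open CommutativeRing K
  open FieldDefs K

  Monomial : ℕ → Set
  Monomial v = Vec ℕ v

  Poly : ℕ → Set c
  Poly v = List (Carrier × Monomial v)

  coeff : ∀ {v} → Poly v → Monomial v → Carrier
  coeff []              α = 0#
  coeff ((a , β) ∷ p) α with VecP.≡-dec ℕP._≟_ β α
  ... | yes _ = a + coeff p α
  ... | no  _ = coeff p α

  _≈P_ : ∀ {v} → Poly v → Poly v → Set ℓ
  p ≈P q = ∀ α → coeff p α ≈ coeff q α

  0P : ∀ {v} → Poly v
  0P = []

  _+P_ : ∀ {v} → Poly v → Poly v → Poly v
  p +P q = p List.++ q

  _*P_ : ∀ {v} → Poly v → Poly v → Poly v
  p *P q = concatMap (λ t → map (λ u → (proj₁ t * proj₁ u , zipWith ℕ._+_ (proj₂ t) (proj₂ u))) q) p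

  1P : ∀ {v} → Poly v
  1P = (1# , replicate _ 0) ∷ []

  -- Variables of K[κ,x] are Fin (suc m + n): first the suc m rate
  -- constants κ (κ_j = inject₁ j for j : Fin m, κ_i' = fromℕ m), then
  -- the n species variables x_s.  An element of K(κ)[x] is a fraction
  -- P / d with P ∈ K[κ,x] and 0 ≠ d ∈ K[κ] (localisation of K[κ,x] at
  -- the nonzero elements of K[κ]).

  Vars : ℕ → ℕ → ℕ
  Vars m n = suc m ℕ.+ n

  InKappa : ∀ m n → Poly (Vars m n) → Set c
  InKappa m n d = All (λ t → ∀ (s : Fin n) → lookup (proj₂ t) (suc m ↑ʳ s) ≡ 0) d

  record RatPoly (m n : ℕ) : Set (c ⊔ ℓ) where
    constructor _/_∣_,_
    field
      num      : Poly (Vars m n)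
      den      : Poly (Vars m n)
      den-κ    : InKappa m n den
      den-≉0   : ¬ (den ≈P 0P)

  RawFrac : ℕ → Set c
  RawFrac v = Poly v × Poly v

  _+F_ : ∀ {v} → RawFrac v → RawFrac v → RawFrac v
  (a , b) +F (a' , b') = ((a *P b') +P (a' *P b)) , (b *P b')

  _≈F_ : ∀ {v} → RawFrac v → RawFrac v → Set ℓ
  (a , b) ≈F (a' , b') = (a *P b') ≈P (a' *P b)

  toRaw : ∀ {m n} → RatPoly m n → RawFrac (Vars m n)
  toRaw g = RatPoly.num g , RatPoly.den g

  lincomb : ∀ {m n} → List (RatPoly m n) → List (Poly (Vars m n)) → RawFrac (Vars m n)
  lincomb {m} {n} (g ∷ gs) (f ∷ fs) = _+F_ {Vars m n} ((RatPoly.num g *P f) , RatPoly.den g) (lincomb gs fs)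
  lincomb _ _ = (0P , 1P)

  _∈Ideal_ : ∀ {m n} → RatPoly m n → List (Poly (Vars m n)) → Set (c ⊔ ℓ)
  _∈Ideal_ {m} {n} g fs = ∃ λ (cs : List (RatPoly m n)) → (length cs ≡ length fs) × (_≈F_ {Vars m n} (toRaw g) (lincomb cs fs))

  _⊆Ideal_ : ∀ {m n} → List (Poly (Vars m n)) → List (Poly (Vars m n)) → Set (c ⊔ ℓ)
  _⊆Ideal_ {m} {n} fs gs = ∀ (h : RatPoly m n) → _∈Ideal_ {m} {n} h fs → _∈Ideal_ {m} {n} h gs

  _≡Ideal_ : ∀ {m n} → List (Poly (Vars m n)) → List (Poly (Vars m n)) → Set (c ⊔ ℓ)
  _≡Ideal_ {m} {n} fs gs = (_⊆Ideal_ {m} {n} fs gs) × (_⊆Ideal_ {m} {n} gs fs)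

-- Reaction networks over the species universe Fin n with m reactions.
-- Complexes are vectors in ℕ^n; reaction j is  y j → y' j.

Complex : ℕ → Set
Complex n = Vec ℕ n

zeroC : ∀ {n} → Complex n
zeroC = replicate _ 0

record IsNetwork {n m : ℕ} (y y' : Fin m → Complex n) : Set where
  field
    nontrivial  : ∀ j → y j ≢ y' j
    noInflow    : ∀ j → y j ≢ zeroC
    distinct    : ∀ j l → y j ≡ y l → y' j ≡ y' l → j ≡ l

IsZeroOne : ∀ {n m} (y y' : Fin m → Complex n) → Set
IsZeroOne y y' = ∀ j s → (lookup (y j) s ≤ 1) × (lookup (y' j) s ≤ 1)

InSpecies : ∀ {n m} (y y' : Fin m → Complex n) → Fin n → Set
InSpecies y y' s = ∃ λ j → (lookup (y j) s ≢ 0) ⊎ (lookup (y' j) s ≢ 0)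

inSpecies? : ∀ {n m} (y y' : Fin m → Complex n) → (s : Fin n) → Dec (InSpecies y y' s)
inSpecies? y y' s = any? (λ j → ¬? (lookup (y j) s ℕP.≟ 0) ⊎-dec ¬? (lookup (y' j) s ℕP.≟ 0))

addSpecies : ∀ {n} → Complex n → Fin n → Complex n
addSpecies c k = Vec.updateAt c k suc

modifyProduct : ∀ {n m} (y' : Fin m → Complex n) (i : Fin m) (k : Fin n) → Fin m → Complex n
modifyProduct y' i k j with j FinP.≟ i
... | yes _ = addSpecies (y' i) k
... | no  _ = y' j

-- Steady-state polynomials and ideal.
-- rate j : Fin (suc m) is the index of the rate constant of reaction j.

module SteadyState {c ℓ : Level} (K : CommutativeRing c ℓ) where
  open CommutativeRing K
  open FieldDefs K
  open PolyDefs K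

  unitVec : ∀ {m} → Fin m → Vec ℕ m
  unitVec a = tabulate (λ b → if does (b FinP.≟ a) then 1 else 0)

  -- ẋ_s = Σ_j κ_{rate j} x^{y j} (y' j s − y j s)
  ssPoly : ∀ {n m} (rate : Fin m → Fin (suc m)) (y y' : Fin m → Complex n) → Fin n → Poly (Vars m n)
  ssPoly rate y y' s =
    map (λ j → ((natK (lookup (y' j) s) + (- natK (lookup (y j) s))) , (unitVec (rate j) ++ y j)))
        (allFin _)

  ssGenerators : ∀ {n m} (rate : Fin m → Fin (suc m)) (y y' : Fin m → Complex n) → List (Poly (Vars m n))
  ssGenerators rate y y' = map (ssPoly rate y y') (filter (inSpecies? y y') (allFin _))

  rateN : ∀ {m} → Fin m → Fin (suc m)
  rateN j = inject₁ j

  rateN' : ∀ {m} → Fin m → Fin m → Fin (suc m)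
  rateN' {m} i j = if does (j FinP.≟ i) then fromℕ m else inject₁ j

data Vertex (m : ℕ) : Set where
  u : Fin m → Vertex m
  v : Fin m → Vertex m

data Edge (n m : ℕ) : Set where
  sp : Fin n → Edge n m
  rx : Fin m → Edge n m

incidence : ∀ {n m} (y y' : Fin m → Complex n) → Vertex m → Edge n m → ℕ
incidence y y' (u j) (sp s) = if does (lookup (y j) s ℕP.≟ 0) then 0 else 1
incidence y y' (v j) (sp s) = if does (lookup (y' j) s ℕP.≟ 0) then 0 else 1
incidence y y' (u j) (rx l) = if does (j FinP.≟ l) then (if does (VecP.≡-dec ℕP._≟_ (y' l) zeroC) then 0 else 1) else 0
incidence y y' (v j) (rx l) = if does (j FinP.≟ l) then (if does (VecP.≡-dec ℕP._≟_ (y' l) zeroC) then 0 else 1) else 0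

sumFin : ∀ k → (Fin k → ℕ) → ℕ
sumFin k f = sumℕ (map f (allFin k))

Multiset : ℕ → ℕ → Set
Multiset n m = Edge n m → ℕ

-- a multiset over the edges of 𝓗_N: species hyperedges exist only for s ∈ 𝒮
IsMultisetOverEdges : ∀ {n m} (y y' : Fin m → Complex n) → Multiset n m → Set
IsMultisetOverEdges y y' ℰ = ∀ s → ¬ InSpecies y y' s → ℰ (sp s) ≡ 0

degree : ∀ {n m} (y y' : Fin m → Complex n) → Multiset n m → Vertex m → ℕ
degree {n} {m} y y' ℰ w =
  sumFin n (λ s → ℰ (sp s) ℕ.* incidence y y' w (sp s))
  ℕ.+ sumFin m (λ j → ℰ (rx j) ℕ.* incidence y y' w (rx j))

_⊔ᴹ_ : ∀ {n m} → Multiset n m → Multiset n m → Multiset n m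
(ℰr ⊔ᴹ ℰb) e = ℰr e ℕ.+ ℰb e

AlmostBalanced : ∀ {n m} (y y' : Fin m → Complex n) (ℰr ℰb : Multiset n m) → Vertex m → Set
AlmostBalanced y y' ℰr ℰb w =
  (∃ λ k → (0 < k) × (degree y y' ℰr w ≡ degree y y' ℰb w ℕ.+ k))
  × (∀ z → z ≢ w → degree y y' ℰr z ≡ degree y y' ℰb z)

open FieldDefs public
open PolyDefs public
open SteadyState public

module Submission where

-- Weight each species s by c_s, the red minus the blue multiplicity of E_s. In a 0,1-network the degree of u_j
-- (of v_j) in a multiset counts the species hyperedges of the reactant (product) of reaction j, plus the
-- reaction hyperedge E_j, which meets u_j and v_j alike. Hence Σ_s c_s ẋ_s = Σ_j (b(v_j) − b(u_j)) κ_j x^(y_j),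
-- where b(w) is the red minus the blue degree of w, and almost balancedness at u_i collapses this to
-- −k κ_i x^(y_i). As c_(s_k) = 0, the same combination of the steady-state polynomials of N' is −k κ_i' x^(y_i).
-- Now ẋ'_s and ẋ_s differ only in their i-th terms, with monomials κ_i' x^(y_i) and κ_i x^(y_i), so
-- k κ_i ẋ'_s is a polynomial combination of the ẋ_s and symmetrically k κ_i' ẋ_s of the ẋ'_s. The factors
-- k κ_i and k κ_i' are units of K(κ), so the two ideals of K(κ)[x] coincide.

open import Defs
  using ( IsFieldChar0; Complex; IsNetwork; IsZeroOne; Multiset; _⊔ᴹ_; IsMultisetOverEdges
        ; AlmostBalanced; u; modifyProduct; sp; _≡Ideal_; ssGenerators; rateN'; rateN )
import Defs
open import Level using (Level; _⊔_)
open import Algebra.Bundles using (CommutativeRing)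
open import Data.Nat as ℕ using (ℕ; zero; suc; z≤n; s≤s)
import Data.Nat.Properties as ℕP
open import Data.Fin as Fin using (Fin)
import Data.Fin.Properties as FinP
open import Data.Vec as Vec using (Vec; []; _∷_; lookup)
import Data.Vec.Properties as VecP
open import Data.List as List using (List; []; _∷_; map; allFin; length)
import Data.List.Properties as ListP
open import Data.List.Relation.Unary.All as All using (All; []; _∷_)
open import Data.List.Relation.Unary.Any as Any using (Any; here; there)
open import Data.Product using (_×_; _,_; proj₁; proj₂)
open import Data.Sum as Sum using (_⊎_; inj₁; inj₂)
open import Function using (_∘_)
open import Relation.Nullary using (¬_; Dec; yes; no; contradiction)
open import Relation.Binary.PropositionalEquality as ≡ using (_≡_; _≢_)

-- Integer coefficients compute,
-- so the solver's normal forms are compared by refl; coefficients from the ring itself would not reduce.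
module IntegerRingSolver {c ℓ} (R : CommutativeRing c ℓ) where
  open import Data.Integer as ℤ using (ℤ; +_; -[1+_]; _⊖_)
  import Data.Integer.Properties as ℤP
  open import Data.Sign as Sign using (Sign)
  open import Data.Maybe using (Maybe; just; nothing)
  open CommutativeRing R
  open import Algebra.Properties.Semiring.Mult semiring using (×-homo-+; ×1-homo-*) renaming (_×_ to _×ℕ_)
  open import Algebra.Properties.Ring ring using (-‿distribˡ-*; -‿distribʳ-*; -‿involutive; -0#≈0#; -‿+-comm)
  open import Algebra.Properties.CommutativeSemigroup +-commutativeSemigroup using (interchange)
  open import Algebra.Solver.Ring.AlmostCommutativeRing
  open import Relation.Binary.Reasoning.Setoid setoid

  ⟦_⟧ : ℤ → Carrier
  ⟦ + n ⟧ = n ×ℕ 1#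
  ⟦ -[1+ n ] ⟧ = - (suc n ×ℕ 1#)

  signed : Sign → Carrier → Carrier
  signed Sign.+ x = x
  signed Sign.- x = - x

  ⟦◃⟧ : ∀ s n → ⟦ s ℤ.◃ n ⟧ ≈ signed s (n ×ℕ 1#)
  ⟦◃⟧ Sign.+ zero = refl
  ⟦◃⟧ Sign.- zero = sym -0#≈0#
  ⟦◃⟧ Sign.+ (suc n) = refl
  ⟦◃⟧ Sign.- (suc n) = refl

  ⟦⟧-signAbs : ∀ i → ⟦ i ⟧ ≈ signed (ℤ.sign i) (ℤ.∣ i ∣ ×ℕ 1#)
  ⟦⟧-signAbs (+ n) = refl
  ⟦⟧-signAbs -[1+ n ] = refl

  signed-* : ∀ s t a b → signed (s Sign.* t) (a * b) ≈ signed s a * signed t b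
  signed-* Sign.+ Sign.+ a b = refl
  signed-* Sign.+ Sign.- a b = -‿distribʳ-* a b
  signed-* Sign.- Sign.+ a b = -‿distribˡ-* a b
  signed-* Sign.- Sign.- a b = begin
    a * b           ≈⟨ -‿involutive _ ⟨
    - - (a * b)     ≈⟨ -‿cong (-‿distribˡ-* a b) ⟩
    - (- a * b)     ≈⟨ -‿distribʳ-* (- a) b ⟩
    - a * - b       ∎

  signed-cong : ∀ s {a b} → a ≈ b → signed s a ≈ signed s b
  signed-cong Sign.+ e = e
  signed-cong Sign.- e = -‿cong e

  *-homo : ∀ i j → ⟦ i ℤ.* j ⟧ ≈ ⟦ i ⟧ * ⟦ j ⟧
  *-homo i j = begin
    ⟦ (sᵢ Sign.* sⱼ) ℤ.◃ (∣i∣ ℕ.* ∣j∣) ⟧              ≈⟨ ⟦◃⟧ (sᵢ Sign.* sⱼ) (∣i∣ ℕ.* ∣j∣) ⟩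
    signed (sᵢ Sign.* sⱼ) ((∣i∣ ℕ.* ∣j∣) ×ℕ 1#)         ≈⟨ signed-cong (sᵢ Sign.* sⱼ) (×1-homo-* ∣i∣ ∣j∣) ⟩
    signed (sᵢ Sign.* sⱼ) ((∣i∣ ×ℕ 1#) * (∣j∣ ×ℕ 1#))  ≈⟨ signed-* sᵢ sⱼ _ _ ⟩
    signed sᵢ (∣i∣ ×ℕ 1#) * signed sⱼ (∣j∣ ×ℕ 1#)     ≈⟨ *-cong (⟦⟧-signAbs i) (⟦⟧-signAbs j) ⟨
    ⟦ i ⟧ * ⟦ j ⟧                                     ∎
    where
    sᵢ = ℤ.sign i; sⱼ = ℤ.sign j; ∣i∣ = ℤ.∣ i ∣; ∣j∣ = ℤ.∣ j ∣

  ⊖-homo : ∀ m n → ⟦ m ⊖ n ⟧ ≈ m ×ℕ 1# + - (n ×ℕ 1#)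
  ⊖-homo m zero = begin
    ⟦ m ⊖ 0 ⟧            ≡⟨ ≡.cong ⟦_⟧ (ℤP.⊖-≥ {m} {0} z≤n) ⟩
    m ×ℕ 1#              ≈⟨ +-identityʳ _ ⟨
    m ×ℕ 1# + 0#         ≈⟨ +-congˡ -0#≈0# ⟨
    m ×ℕ 1# + - 0#       ∎
  ⊖-homo zero (suc n) = begin
    ⟦ 0 ⊖ suc n ⟧            ≡⟨ ≡.cong ⟦_⟧ (ℤP.⊖-< {0} {suc n} (s≤s z≤n)) ⟩
    - (suc n ×ℕ 1#)          ≈⟨ +-identityˡ _ ⟨
    0# + - (suc n ×ℕ 1#)     ∎
  ⊖-homo (suc m) (suc n) = begin
    ⟦ suc m ⊖ suc n ⟧              ≡⟨ ≡.cong ⟦_⟧ (ℤP.[1+m]⊖[1+n]≡m⊖n m n) ⟩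
    ⟦ m ⊖ n ⟧                      ≈⟨ ⊖-homo m n ⟩
    a + - b                        ≈⟨ +-identityˡ _ ⟨
    0# + (a + - b)                 ≈⟨ +-congʳ (-‿inverseʳ 1#) ⟨
    (1# + - 1#) + (a + - b)        ≈⟨ interchange 1# (- 1#) a (- b) ⟩
    (1# + a) + (- 1# + - b)        ≈⟨ +-congˡ (-‿+-comm 1# b) ⟩
    (1# + a) + - (1# + b)          ∎
    where a = m ×ℕ 1#; b = n ×ℕ 1#

  +-homo : ∀ i j → ⟦ i ℤ.+ j ⟧ ≈ ⟦ i ⟧ + ⟦ j ⟧
  +-homo (+ m) (+ n) = ×-homo-+ 1# m n
  +-homo (+ m) -[1+ n ] = ⊖-homo m (suc n)
  +-homo -[1+ m ] (+ n) = trans (⊖-homo n (suc m)) (+-comm _ _)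
  +-homo -[1+ m ] -[1+ n ] = begin
    - (suc (suc (m ℕ.+ n)) ×ℕ 1#)         ≡⟨ ≡.cong (λ k → - (suc k ×ℕ 1#)) (ℕP.+-suc m n) ⟨
    - ((suc m ℕ.+ suc n) ×ℕ 1#)           ≈⟨ -‿cong (×-homo-+ 1# (suc m) (suc n)) ⟩
    - (suc m ×ℕ 1# + suc n ×ℕ 1#)         ≈⟨ -‿+-comm _ _ ⟨
    - (suc m ×ℕ 1#) + - (suc n ×ℕ 1#)     ∎

  -‿homo : ∀ i → ⟦ ℤ.- i ⟧ ≈ - ⟦ i ⟧
  -‿homo (+ zero) = sym -0#≈0#
  -‿homo (+ suc n) = refl
  -‿homo -[1+ n ] = sym (-‿involutive _)

  ℤ⟶R : ℤ.+-*-rawRing -Raw-AlmostCommutative⟶ fromCommutativeRing R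
  ℤ⟶R = record
    { ⟦_⟧ = ⟦_⟧ ; +-homo = +-homo ; *-homo = *-homo ; -‿homo = -‿homo
    ; 0-homo = refl ; 1-homo = +-identityʳ 1# }

  ⟦⟧-≟ : ∀ i j → Maybe (⟦ i ⟧ ≈ ⟦ j ⟧)
  ⟦⟧-≟ i j with i ℤ.≟ j
  ... | yes i≡j = just (reflexive (≡.cong ⟦_⟧ i≡j))
  ... | no _ = nothing

  open import Algebra.Solver.Ring ℤ.+-*-rawRing (fromCommutativeRing R) ℤ⟶R ⟦⟧-≟
    public using (solve; _:=_; _:+_; _:*_; :-_; _:-_)


module ListSums {c ℓ} (R : CommutativeRing c ℓ) where
  open CommutativeRing R
  open import Algebra.Properties.Ring ring using (-0#≈0#; -‿+-comm)
  open IntegerRingSolver R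
  open import Relation.Binary.Reasoning.Setoid setoid

  module _ {a} {A : Set a} where

    ∑ : List A → (A → Carrier) → Carrier
    ∑ []       f = 0#
    ∑ (x ∷ xs) f = f x + ∑ xs f

    ∑-cong : ∀ xs {f g : A → Carrier} → (∀ x → f x ≈ g x) → ∑ xs f ≈ ∑ xs g
    ∑-cong []       f≈g = refl
    ∑-cong (x ∷ xs) f≈g = +-cong (f≈g x) (∑-cong xs f≈g)

    ∑-congᴬ : ∀ {p} {P : A → Set p} {xs} {f g : A → Carrier} →
              All P xs → (∀ x → P x → f x ≈ g x) → ∑ xs f ≈ ∑ xs g
    ∑-congᴬ []         f≈g = refl
    ∑-congᴬ (px ∷ pxs) f≈g = +-cong (f≈g _ px) (∑-congᴬ pxs f≈g)

    ∑-zero : ∀ xs {f : A → Carrier} → (∀ x → f x ≈ 0#) → ∑ xs f ≈ 0#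
    ∑-zero []       f≈0 = refl
    ∑-zero (x ∷ xs) f≈0 = trans (+-cong (f≈0 x) (∑-zero xs f≈0)) (+-identityˡ 0#)

    ∑-+ : ∀ xs (f g : A → Carrier) → ∑ xs (λ x → f x + g x) ≈ ∑ xs f + ∑ xs g
    ∑-+ []       f g = sym (+-identityˡ 0#)
    ∑-+ (x ∷ xs) f g = trans (+-congˡ (∑-+ xs f g))
      (solve 4 (λ a b c d → (a :+ b) :+ (c :+ d) := (a :+ c) :+ (b :+ d)) refl (f x) (g x) (∑ xs f) (∑ xs g))

    ∑-neg : ∀ xs (f : A → Carrier) → ∑ xs (λ x → - f x) ≈ - ∑ xs f
    ∑-neg []       f = sym -0#≈0#
    ∑-neg (x ∷ xs) f = trans (+-congˡ (∑-neg xs f)) (-‿+-comm (f x) (∑ xs f))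

    ∑-*ˡ : ∀ xs b (f : A → Carrier) → ∑ xs (λ x → b * f x) ≈ b * ∑ xs f
    ∑-*ˡ []       b f = sym (zeroʳ b)
    ∑-*ˡ (x ∷ xs) b f = trans (+-congˡ (∑-*ˡ xs b f)) (sym (distribˡ b _ _))

    ∑-*ʳ : ∀ xs b (f : A → Carrier) → ∑ xs (λ x → f x * b) ≈ ∑ xs f * b
    ∑-*ʳ xs b f = trans (∑-cong xs (λ x → *-comm (f x) b)) (trans (∑-*ˡ xs b f) (*-comm b _))

  ∑-map : ∀ {a b} {A : Set a} {B : Set b} (g : A → B) xs (f : B → Carrier) →
          ∑ (map g xs) f ≡ ∑ xs (f ∘ g)
  ∑-map g []       f = ≡.refl
  ∑-map g (x ∷ xs) f = ≡.cong (f (g x) +_) (∑-map g xs f)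

  ∑-swap : ∀ {a b} {A : Set a} {B : Set b} (xs : List A) (ys : List B) (F : A → B → Carrier) →
           ∑ xs (λ x → ∑ ys (F x)) ≈ ∑ ys (λ y → ∑ xs (λ x → F x y))
  ∑-swap []       ys F = sym (∑-zero ys (λ _ → refl))
  ∑-swap (x ∷ xs) ys F = trans (+-congˡ (∑-swap xs ys F)) (sym (∑-+ ys (F x) _))

  ∑-allFin-suc : ∀ {m} (f : Fin (suc m) → Carrier) →
                 ∑ (allFin (suc m)) f ≈ f Fin.zero + ∑ (allFin m) (f ∘ Fin.suc)
  ∑-allFin-suc {m} f = +-congˡ (begin
    ∑ (List.tabulate Fin.suc) f        ≡⟨ ≡.cong (λ xs → ∑ xs f) (ListP.map-tabulate (λ j → j) Fin.suc) ⟨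
    ∑ (map Fin.suc (allFin m)) f       ≡⟨ ∑-map Fin.suc (allFin m) f ⟩
    ∑ (allFin m) (f ∘ Fin.suc)         ∎)

  ∑-allFin-onlyAt : ∀ {m} (i : Fin m) (f : Fin m → Carrier) →
                    (∀ j → j ≢ i → f j ≈ 0#) → ∑ (allFin m) f ≈ f i
  ∑-allFin-onlyAt {suc m} Fin.zero f f≈0 = begin
    ∑ (allFin (suc m)) f               ≈⟨ ∑-allFin-suc f ⟩
    f Fin.zero + ∑ (allFin m) (f ∘ Fin.suc) ≈⟨ +-congˡ (∑-zero (allFin m) (λ j → f≈0 (Fin.suc j) (λ ()))) ⟩
    f Fin.zero + 0#                    ≈⟨ +-identityʳ _ ⟩
    f Fin.zero                         ∎
  ∑-allFin-onlyAt {suc m} (Fin.suc i) f f≈0 = begin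
    ∑ (allFin (suc m)) f               ≈⟨ ∑-allFin-suc f ⟩
    f Fin.zero + ∑ (allFin m) (f ∘ Fin.suc) ≈⟨ +-congʳ (f≈0 Fin.zero (λ ())) ⟩
    0# + ∑ (allFin m) (f ∘ Fin.suc)    ≈⟨ +-identityˡ _ ⟩
    ∑ (allFin m) (f ∘ Fin.suc)
      ≈⟨ ∑-allFin-onlyAt i (f ∘ Fin.suc) (λ j j≢i → f≈0 (Fin.suc j) (j≢i ∘ FinP.suc-injective)) ⟩
    f (Fin.suc i)                      ∎

  ∑-allFin-exceptAt : ∀ {m} (i : Fin m) (f g : Fin m → Carrier) → (∀ j → j ≢ i → f j ≈ g j) →
                      ∑ (allFin m) f ≈ ∑ (allFin m) g + (f i - g i)
  ∑-allFin-exceptAt {m} i f g f≈g = begin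
    ∑ (allFin m) f                                          ≈⟨ solve 2 (λ a b → a := b :+ (a :- b)) refl _ _ ⟩
    ∑ (allFin m) g + (∑ (allFin m) f - ∑ (allFin m) g)      ≈⟨ +-congˡ (+-congˡ (∑-neg (allFin m) g)) ⟨
    ∑ (allFin m) g + (∑ (allFin m) f + ∑ (allFin m) (-_ ∘ g)) ≈⟨ +-congˡ (∑-+ (allFin m) f (-_ ∘ g)) ⟨
    ∑ (allFin m) g + ∑ (allFin m) (λ j → f j - g j)
      ≈⟨ +-congˡ (∑-allFin-onlyAt i _ (λ j j≢i → trans (+-congʳ (f≈g j j≢i)) (-‿inverseʳ (g j)))) ⟩
    ∑ (allFin m) g + (f i - g i)                            ∎

module LinearCombinations {c ℓ} (R : CommutativeRing c ℓ) where
  open CommutativeRing R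
  open IntegerRingSolver R
  open ListSums R using (∑)
  open import Data.List.Membership.Propositional using (_∈_)
  open import Relation.Binary.Reasoning.Setoid setoid

  weightedSum : List Carrier → List Carrier → Carrier
  weightedSum (a ∷ as) (g ∷ gs) = a * g + weightedSum as gs
  weightedSum _        _        = 0#

  infix 4 _∈Span_
  record _∈Span_ (p : Carrier) (gs : List Carrier) : Set (c ⊔ ℓ) where
    constructor spanned
    field
      coefficients : List Carrier
      length-≡     : length coefficients ≡ length gs
      ≈weightedSum : p ≈ weightedSum coefficients gs

  ∈Span-resp-≈ : ∀ {gs p q} → p ≈ q → p ∈Span gs → q ∈Span gs
  ∈Span-resp-≈ p≈q (spanned as len p≈) = spanned as len (trans (sym p≈q) p≈)

  weightedSum-zeros : ∀ gs → weightedSum (map (λ _ → 0#) gs) gs ≈ 0#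
  weightedSum-zeros []       = refl
  weightedSum-zeros (g ∷ gs) = trans (+-cong (zeroˡ g) (weightedSum-zeros gs)) (+-identityˡ 0#)

  0∈Span : ∀ gs → 0# ∈Span gs
  0∈Span gs = spanned (map (λ _ → 0#) gs) (ListP.length-map _ gs) (sym (weightedSum-zeros gs))

  weightedSum-+ : ∀ as bs gs → length as ≡ length gs → length bs ≡ length gs →
              length (List.zipWith _+_ as bs) ≡ length gs ×
              weightedSum (List.zipWith _+_ as bs) gs ≈ weightedSum as gs + weightedSum bs gs
  weightedSum-+ []       []       []       _   _   = ≡.refl , sym (+-identityˡ 0#)
  weightedSum-+ (a ∷ as) (b ∷ bs) (g ∷ gs) las lbs
    with len , ≈sum ← weightedSum-+ as bs gs (ℕP.suc-injective las) (ℕP.suc-injective lbs) =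
    ≡.cong suc len , (begin
      (a + b) * g + weightedSum (List.zipWith _+_ as bs) gs     ≈⟨ +-congˡ ≈sum ⟩
      (a + b) * g + (weightedSum as gs + weightedSum bs gs)
        ≈⟨ solve 5 (λ a b g x y → (a :+ b) :* g :+ (x :+ y) := (a :* g :+ x) :+ (b :* g :+ y)) refl a b g _ _ ⟩
      (a * g + weightedSum as gs) + (b * g + weightedSum bs gs)     ∎)

  ∈Span-+ : ∀ {gs p q} → p ∈Span gs → q ∈Span gs → p + q ∈Span gs
  ∈Span-+ {gs} (spanned as las p≈) (spanned bs lbs q≈) with len , ≈sum ← weightedSum-+ as bs gs las lbs =
    spanned (List.zipWith _+_ as bs) len (trans (+-cong p≈ q≈) (sym ≈sum))

  weightedSum-*ˡ : ∀ r as gs → weightedSum (map (r *_) as) gs ≈ r * weightedSum as gs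
  weightedSum-*ˡ r []       gs       = sym (zeroʳ r)
  weightedSum-*ˡ r (a ∷ as) []       = sym (zeroʳ r)
  weightedSum-*ˡ r (a ∷ as) (g ∷ gs) = begin
    r * a * g + weightedSum (map (r *_) as) gs    ≈⟨ +-congˡ (weightedSum-*ˡ r as gs) ⟩
    r * a * g + r * weightedSum as gs
      ≈⟨ solve 4 (λ r a g x → r :* a :* g :+ r :* x := r :* (a :* g :+ x)) refl r a g _ ⟩
    r * (a * g + weightedSum as gs)               ∎

  ∈Span-*ˡ : ∀ {gs p} r → p ∈Span gs → r * p ∈Span gs
  ∈Span-*ˡ {gs} r (spanned as len p≈) =
    spanned (map (r *_) as) (≡.trans (ListP.length-map _ as) len) (trans (*-congˡ p≈) (sym (weightedSum-*ˡ r as gs)))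

  ∈Span-member : ∀ {gs g} → g ∈ gs → g ∈Span gs
  ∈Span-member {h ∷ gs} (here ≡.refl) =
    spanned (1# ∷ map (λ _ → 0#) gs) (≡.cong suc (ListP.length-map _ gs))
            (sym (trans (+-cong (*-identityˡ h) (weightedSum-zeros gs)) (+-identityʳ h)))
  ∈Span-member {h ∷ gs} (there g∈gs) with spanned as len g≈ ← ∈Span-member g∈gs =
    spanned (0# ∷ as) (≡.cong suc len) (trans g≈ (sym (trans (+-congʳ (zeroˡ h)) (+-identityˡ _))))

  ∈Span-∑ : ∀ {a} {A : Set a} {gs} xs (F : A → Carrier) → (∀ x → F x ∈Span gs) → ∑ xs F ∈Span gs
  ∈Span-∑ {gs = gs} []       F F∈ = 0∈Span gs
  ∈Span-∑           (x ∷ xs) F F∈ = ∈Span-+ (F∈ x) (∈Span-∑ xs F F∈)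

  -- Using t a' = t' a: X' (k t) = (k t) X + (e t − e' t') (− k a).
  ∈Span-exchange : ∀ {gs} X X' a a' e e' t t' k P →
                   X' ≈ X + (e' * a' - e * a) → t * a' ≈ t' * a → P ≈ - (k * a) →
                   X ∈Span gs → P ∈Span gs → X' * (k * t) ∈Span gs
  ∈Span-exchange X X' a a' e e' t t' k P X'≈ ta'≈t'a P≈ X∈ P∈ =
    ∈Span-resp-≈ regroup (∈Span-+ (∈Span-*ˡ (k * t) X∈) (∈Span-*ˡ (e * t - e' * t') P∈))
    where
    regroup : k * t * X + (e * t - e' * t') * P ≈ X' * (k * t)
    regroup = begin
      k * t * X + (e * t - e' * t') * P                ≈⟨ +-congˡ (*-congˡ P≈) ⟩
      k * t * X + (e * t - e' * t') * - (k * a)        ≈⟨ solve 8 (λ k t X e e' t' a a' →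
                                                            k :* t :* X :+ (e :* t :- e' :* t') :* (:- (k :* a))
                                                         := X :* (k :* t) :+ k :* e' :* (t' :* a) :- e :* a :* (k :* t))
                                                          refl k t X e e' t' a a' ⟩
      X * (k * t) + k * e' * (t' * a) - e * a * (k * t) ≈⟨ +-congʳ (+-congˡ (*-congˡ ta'≈t'a)) ⟨
      X * (k * t) + k * e' * (t * a') - e * a * (k * t) ≈⟨ solve 8 (λ k t X e e' t' a a' →
                                                            X :* (k :* t) :+ k :* e' :* (t :* a') :- e :* a :* (k :* t)
                                                         := (X :+ (e' :* a' :- e :* a)) :* (k :* t))
                                                          refl k t X e e' t' a a' ⟩
      (X + (e' * a' - e * a)) * (k * t)                ≈⟨ *-congʳ X'≈ ⟨
      X' * (k * t)                                     ∎


module Polynomials {c ℓ} (K : CommutativeRing c ℓ) where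
  open CommutativeRing K
  open import Algebra.Properties.Ring ring using (-0#≈0#; -‿+-comm)
  open Defs.PolyDefs K using (Monomial; Poly; coeff; 0P; 1P; _+P_; _*P_)
  open ListSums K
  open import Relation.Binary.Reasoning.Setoid setoid

  Term : ℕ → Set c
  Term v = Carrier × Monomial v

  infixl 6 _⊕_ _⊖_
  _⊕_ _⊖_ : ∀ {v} → Monomial v → Monomial v → Monomial v
  _⊕_ = Vec.zipWith ℕ._+_
  _⊖_ = Vec.zipWith ℕ._∸_

  ⊕-comm : ∀ {v} (β γ : Monomial v) → β ⊕ γ ≡ γ ⊕ β
  ⊕-comm = VecP.zipWith-comm ℕP.+-comm

  ⊕-assoc : ∀ {v} (β γ μ : Monomial v) → β ⊕ γ ⊕ μ ≡ β ⊕ (γ ⊕ μ)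
  ⊕-assoc = VecP.zipWith-assoc ℕP.+-assoc

  ⊕-identityˡ : ∀ {v} (β : Monomial v) → Vec.replicate v 0 ⊕ β ≡ β
  ⊕-identityˡ = VecP.zipWith-identityˡ ℕP.+-identityˡ

  ⊖-identityʳ : ∀ {v} (β : Monomial v) → β ⊖ Vec.replicate v 0 ≡ β
  ⊖-identityʳ = VecP.zipWith-identityʳ (λ _ → ≡.refl)

  ⊕-⊖-cancelˡ : ∀ {v} (β γ : Monomial v) → β ⊕ γ ⊖ β ≡ γ
  ⊕-⊖-cancelˡ []      []      = ≡.refl
  ⊕-⊖-cancelˡ (b ∷ β) (g ∷ γ) = ≡.cong₂ _∷_ (ℕP.m+n∸m≡n b g) (⊕-⊖-cancelˡ β γ)

  infix 4 _≟ₘ_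
  _≟ₘ_ : ∀ {v} (β γ : Monomial v) → Dec (β ≡ γ)
  _≟ₘ_ = VecP.≡-dec ℕP._≟_

  δ : ∀ {v} → Monomial v → Monomial v → Carrier → Carrier
  δ β α a with β ≟ₘ α
  ... | yes _ = a
  ... | no  _ = 0#

  module _ {v} {β α : Monomial v} where

    δ-≡ : ∀ a → β ≡ α → δ β α a ≈ a
    δ-≡ a β≡α with β ≟ₘ α
    ... | yes _   = refl
    ... | no  β≢α = contradiction β≡α β≢α

    δ-≢ : ∀ a → β ≢ α → δ β α a ≈ 0#
    δ-≢ a β≢α with β ≟ₘ α
    ... | yes β≡α = contradiction β≡α β≢α
    ... | no  _   = refl

  module _ {v} (β α : Monomial v) where

    δ-cong : ∀ {a b} → a ≈ b → δ β α a ≈ δ β α b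
    δ-cong a≈b with β ≟ₘ α
    ... | yes _ = a≈b
    ... | no  _ = refl

    δ-0 : δ β α 0# ≈ 0#
    δ-0 with β ≟ₘ α
    ... | yes _ = refl
    ... | no  _ = refl

    δ-+ : ∀ a b → δ β α (a + b) ≈ δ β α a + δ β α b
    δ-+ a b with β ≟ₘ α
    ... | yes _ = refl
    ... | no  _ = sym (+-identityˡ 0#)

    δ-*ˡ : ∀ a b → δ β α (a * b) ≈ a * δ β α b
    δ-*ˡ a b with β ≟ₘ α
    ... | yes _ = refl
    ... | no  _ = sym (zeroʳ a)

    δ-neg : ∀ a → δ β α (- a) ≈ - δ β α a
    δ-neg a with β ≟ₘ α
    ... | yes _ = refl
    ... | no  _ = sym -0#≈0#

    δ-∑ : ∀ {a} {A : Set a} xs (f : A → Carrier) → δ β α (∑ xs f) ≈ ∑ xs (λ x → δ β α (f x))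
    δ-∑ []       f = δ-0
    δ-∑ (x ∷ xs) f = trans (δ-+ _ _) (+-congˡ (δ-∑ xs f))

  coeff-∷ : ∀ {v} a (β : Monomial v) p α → coeff ((a , β) ∷ p) α ≈ δ β α a + coeff p α
  coeff-∷ a β p α with β ≟ₘ α
  ... | yes _ = refl
  ... | no  _ = sym (+-identityˡ _)

  coeff-∑ : ∀ {v} (p : Poly v) α → coeff p α ≈ ∑ p (λ t → δ (proj₂ t) α (proj₁ t))
  coeff-∑ []            α = refl
  coeff-∑ ((a , β) ∷ p) α = trans (coeff-∷ a β p α) (+-congˡ (coeff-∑ p α))

  coeff-++ : ∀ {v} (p q : Poly v) α → coeff (p List.++ q) α ≈ coeff p α + coeff q α
  coeff-++ []            q α = sym (+-identityˡ _)
  coeff-++ ((a , β) ∷ p) q α = begin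
    coeff ((a , β) ∷ p List.++ q) α      ≈⟨ coeff-∷ a β _ α ⟩
    δ β α a + coeff (p List.++ q) α      ≈⟨ +-congˡ (coeff-++ p q α) ⟩
    δ β α a + (coeff p α + coeff q α)    ≈⟨ +-assoc _ _ _ ⟨
    (δ β α a + coeff p α) + coeff q α    ≈⟨ +-congʳ (coeff-∷ a β p α) ⟨
    coeff ((a , β) ∷ p) α + coeff q α    ∎

  coeff-map : ∀ {a} {A : Set a} {v} (f : A → Term v) xs α →
              coeff (map f xs) α ≈ ∑ xs (λ x → δ (proj₂ (f x)) α (proj₁ (f x)))
  coeff-map f xs α = trans (coeff-∑ (map f xs) α) (reflexive (∑-map f xs _))

  -- A record, unlike the function type _≈P_ of the same content, lets p and q be inferred from a proof.
  infix 4 _≋_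
  record _≋_ {v} (p q : Poly v) : Set ℓ where
    constructor coeffwise
    field coeff-≈ : ∀ α → coeff p α ≈ coeff q α
  open _≋_ public

  module _ {v : ℕ} where

    ≋-refl : {p : Poly v} → p ≋ p
    ≋-refl = coeffwise λ _ → refl

    ≋-sym : {p q : Poly v} → p ≋ q → q ≋ p
    ≋-sym p≋q = coeffwise λ α → sym (coeff-≈ p≋q α)

    ≋-trans : {p q r : Poly v} → p ≋ q → q ≋ r → p ≋ r
    ≋-trans p≋q q≋r = coeffwise λ α → trans (coeff-≈ p≋q α) (coeff-≈ q≋r α)

    ≡⇒≋ : {p q : Poly v} → p ≡ q → p ≋ q
    ≡⇒≋ ≡.refl = ≋-refl

    map-≋ : ∀ {a} {A : Set a} (f g : A → Term v) xs →
            (∀ x → proj₁ (f x) ≈ proj₁ (g x)) → (∀ x → proj₂ (f x) ≡ proj₂ (g x)) → map f xs ≋ map g xs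
    map-≋ f g xs f≈g f≡g = coeffwise λ α → begin
      coeff (map f xs) α                                ≈⟨ coeff-map f xs α ⟩
      ∑ xs (λ x → δ (proj₂ (f x)) α (proj₁ (f x)))      ≈⟨ ∑-cong xs (λ x → trans (δ-cong (proj₂ (f x)) α (f≈g x))
                                                             (reflexive (≡.cong (λ β → δ β α _) (f≡g x)))) ⟩
      ∑ xs (λ x → δ (proj₂ (g x)) α (proj₁ (g x)))      ≈⟨ coeff-map g xs α ⟨
      coeff (map g xs) α                                ∎

  coeff-concatMap : ∀ {a} {A : Set a} {v} (f : A → Poly v) xs α →
                    coeff (List.concatMap f xs) α ≈ ∑ xs (λ x → coeff (f x) α)
  coeff-concatMap f []       α = refl
  coeff-concatMap f (x ∷ xs) α = trans (coeff-++ (f x) _ α) (+-congˡ (coeff-concatMap f xs α))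

  scale : ∀ {v} → Term v → Poly v → Poly v
  scale t q = map (λ w → (proj₁ t * proj₁ w , proj₂ t ⊕ proj₂ w)) q

  -- The coefficient of x^α in x^β q: that of x^(α ∸ β) in q when β ≤ α componentwise, which is what
  -- β ⊕ (α ⊖ β) ≡ α tests, and 0 otherwise.
  shifted : ∀ {v} → Monomial v → Poly v → Monomial v → Carrier
  shifted β q α with β ⊕ (α ⊖ β) ≟ₘ α
  ... | yes _ = coeff q (α ⊖ β)
  ... | no  _ = 0#

  module _ {v} (β γ α : Monomial v) where

    δ-⊕ : ∀ a b → β ⊕ (α ⊖ β) ≡ α → δ (β ⊕ γ) α (a * b) ≈ a * δ γ (α ⊖ β) b
    δ-⊕ a b β≤α with β ⊕ γ ≟ₘ α | γ ≟ₘ α ⊖ β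
    ... | yes _  | yes _ = refl
    ... | no  _  | no  _ = sym (zeroʳ a)
    ... | yes e  | no ne = contradiction (≡.trans (≡.sym (⊕-⊖-cancelˡ β γ)) (≡.cong (_⊖ β) e)) ne
    ... | no ne  | yes e = contradiction (≡.trans (≡.cong (β ⊕_) e) β≤α) ne

    δ-⊕-≰ : ∀ a → β ⊕ (α ⊖ β) ≢ α → δ (β ⊕ γ) α a ≈ 0#
    δ-⊕-≰ a β≰α = δ-≢ a λ e →
      β≰α (≡.subst (λ μ → β ⊕ μ ≡ α) (≡.trans (≡.sym (⊕-⊖-cancelˡ β γ)) (≡.cong (_⊖ β) e)) e)

  coeff-scale : ∀ {v} a (β : Monomial v) q α → coeff (scale (a , β) q) α ≈ a * shifted β q α
  coeff-scale a β q α with β ⊕ (α ⊖ β) ≟ₘ α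
  ... | yes β≤α = begin
    coeff (scale (a , β) q) α                               ≈⟨ coeff-map _ q α ⟩
    ∑ q (λ w → δ (β ⊕ proj₂ w) α (a * proj₁ w))             ≈⟨ ∑-cong q (λ w → δ-⊕ β (proj₂ w) α a (proj₁ w) β≤α) ⟩
    ∑ q (λ w → a * δ (proj₂ w) (α ⊖ β) (proj₁ w))           ≈⟨ ∑-*ˡ q a _ ⟩
    a * ∑ q (λ w → δ (proj₂ w) (α ⊖ β) (proj₁ w))           ≈⟨ *-congˡ (coeff-∑ q (α ⊖ β)) ⟨
    a * coeff q (α ⊖ β)                                     ∎
  ... | no β≰α = begin
    coeff (scale (a , β) q) α                               ≈⟨ coeff-map _ q α ⟩
    ∑ q (λ w → δ (β ⊕ proj₂ w) α (a * proj₁ w))             ≈⟨ ∑-zero q (λ w → δ-⊕-≰ β (proj₂ w) α _ β≰α) ⟩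
    0#                                                      ≈⟨ zeroʳ a ⟨
    a * 0#                                                  ∎

  shifted-cong : ∀ {v} (β α : Monomial v) {q q'} → q ≋ q' → shifted β q α ≈ shifted β q' α
  shifted-cong β α q≋q' with β ⊕ (α ⊖ β) ≟ₘ α
  ... | yes _ = coeff-≈ q≋q' (α ⊖ β)
  ... | no  _ = refl

  shifted-++ : ∀ {v} (β α : Monomial v) q r → shifted β (q +P r) α ≈ shifted β q α + shifted β r α
  shifted-++ β α q r with β ⊕ (α ⊖ β) ≟ₘ α
  ... | yes _ = coeff-++ q r (α ⊖ β)
  ... | no  _ = sym (+-identityˡ 0#)

  coeff-* : ∀ {v} (p q : Poly v) α → coeff (p *P q) α ≈ ∑ p (λ t → proj₁ t * shifted (proj₂ t) q α)
  coeff-* p q α = trans (coeff-concatMap (λ t → scale t q) p α) (∑-cong p (λ t → coeff-scale (proj₁ t) (proj₂ t) q α))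

  coeff-*-∑∑ : ∀ {v} (p q : Poly v) α →
               coeff (p *P q) α ≈ ∑ p (λ t → ∑ q (λ w → δ (proj₂ t ⊕ proj₂ w) α (proj₁ t * proj₁ w)))
  coeff-*-∑∑ p q α = trans (coeff-concatMap (λ t → scale t q) p α) (∑-cong p (λ t → coeff-map _ q α))

  module _ {v : ℕ} where

    +P-cong : {p p' q q' : Poly v} → p ≋ p' → q ≋ q' → p +P q ≋ p' +P q'
    +P-cong {p} {p'} {q} {q'} p≋p' q≋q' = coeffwise λ α →
      trans (coeff-++ p q α) (trans (+-cong (coeff-≈ p≋p' α) (coeff-≈ q≋q' α)) (sym (coeff-++ p' q' α)))

    *P-congˡ : (p : Poly v) {q q' : Poly v} → q ≋ q' → p *P q ≋ p *P q'
    *P-congˡ p {q} {q'} q≋q' = coeffwise λ α →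
      trans (coeff-* p q α) (trans (∑-cong p (λ t → *-congˡ (shifted-cong (proj₂ t) α q≋q'))) (sym (coeff-* p q' α)))

    *P-comm : (p q : Poly v) → p *P q ≋ q *P p
    *P-comm p q = coeffwise λ α → begin
      coeff (p *P q) α                                                      ≈⟨ coeff-*-∑∑ p q α ⟩
      ∑ p (λ t → ∑ q (λ w → δ (proj₂ t ⊕ proj₂ w) α (proj₁ t * proj₁ w)))  ≈⟨ ∑-swap p q _ ⟩
      ∑ q (λ w → ∑ p (λ t → δ (proj₂ t ⊕ proj₂ w) α (proj₁ t * proj₁ w)))  ≈⟨ ∑-cong q (λ w → ∑-cong p (λ t → swapped t w)) ⟩
      ∑ q (λ w → ∑ p (λ t → δ (proj₂ w ⊕ proj₂ t) α (proj₁ w * proj₁ t)))  ≈⟨ coeff-*-∑∑ q p α ⟨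
      coeff (q *P p) α                                                      ∎
      where
      swapped : ∀ (t w : Term v) {α} →
                δ (proj₂ t ⊕ proj₂ w) α (proj₁ t * proj₁ w) ≈ δ (proj₂ w ⊕ proj₂ t) α (proj₁ w * proj₁ t)
      swapped t w {α} = trans (δ-cong (proj₂ t ⊕ proj₂ w) α (*-comm _ _))
                              (reflexive (≡.cong (λ β → δ β α _) (⊕-comm (proj₂ t) (proj₂ w))))

    *P-congʳ : (p : Poly v) {q q' : Poly v} → q ≋ q' → q *P p ≋ q' *P p
    *P-congʳ p {q} {q'} q≋q' = ≋-trans (*P-comm q p) (≋-trans (*P-congˡ p q≋q') (*P-comm p q'))

    *P-cong : {p p' q q' : Poly v} → p ≋ p' → q ≋ q' → p *P q ≋ p' *P q'
    *P-cong {p} {p'} {q} {q'} p≋p' q≋q' = ≋-trans (*P-congʳ q p≋p') (*P-congˡ p' q≋q')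

    scale-scale : ∀ (s t : Term v) r → scale (proj₁ s * proj₁ t , proj₂ s ⊕ proj₂ t) r ≋ scale s (scale t r)
    scale-scale (a , β) (b , γ) r = ≡.subst (scale (a * b , β ⊕ γ) r ≋_) (ListP.map-∘ r)
      (map-≋ _ _ r (λ w → *-assoc a b (proj₁ w)) (λ w → ⊕-assoc β γ (proj₂ w)))

    scale-* : ∀ t (q r : Poly v) → (scale t q) *P r ≋ scale t (q *P r)
    scale-* t []      r = ≋-refl
    scale-* t (s ∷ q) r = ≋-trans (+P-cong (scale-scale t s r) (scale-* t q r))
      (≡⇒≋ (≡.sym (ListP.map-++ _ (scale s r) (q *P r))))

    *P-distribʳ : (p q r : Poly v) → (q +P r) *P p ≋ (q *P p) +P (r *P p)
    *P-distribʳ p q r = ≡⇒≋ (ListP.concatMap-++ (λ t → scale t p) q r)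

    *P-assoc : (p q r : Poly v) → (p *P q) *P r ≋ p *P (q *P r)
    *P-assoc []      q r = ≋-refl
    *P-assoc (t ∷ p) q r = ≋-trans (*P-distribʳ r (scale t q) (p *P q)) (+P-cong (scale-* t q r) (*P-assoc p q r))

    *P-distribˡ : (p q r : Poly v) → p *P (q +P r) ≋ (p *P q) +P (p *P r)
    *P-distribˡ p q r = coeffwise λ α → begin
      coeff (p *P (q +P r)) α                                     ≈⟨ coeff-* p (q +P r) α ⟩
      ∑ p (λ t → proj₁ t * shifted (proj₂ t) (q +P r) α)
        ≈⟨ ∑-cong p (λ t → trans (*-congˡ (shifted-++ (proj₂ t) α q r)) (distribˡ _ _ _)) ⟩
      ∑ p (λ t → proj₁ t * shifted (proj₂ t) q α + proj₁ t * shifted (proj₂ t) r α) ≈⟨ ∑-+ p _ _ ⟩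
      ∑ p (λ t → proj₁ t * shifted (proj₂ t) q α) + ∑ p (λ t → proj₁ t * shifted (proj₂ t) r α)
                                                                  ≈⟨ +-cong (coeff-* p q α) (coeff-* p r α) ⟨
      coeff (p *P q) α + coeff (p *P r) α                         ≈⟨ coeff-++ (p *P q) (p *P r) α ⟨
      coeff ((p *P q) +P (p *P r)) α                                  ∎

    +P-identityʳ : (p : Poly v) → p +P 0P ≋ p
    +P-identityʳ p = ≡⇒≋ (ListP.++-identityʳ p)

    *P-identityˡ : (p : Poly v) → 1P *P p ≋ p
    *P-identityˡ p = ≋-trans (+P-identityʳ (scale (1# , Vec.replicate v 0) p))
      (≋-trans (map-≋ _ (λ w → w) p (λ w → *-identityˡ (proj₁ w)) (λ w → ⊕-identityˡ (proj₂ w))) (≡⇒≋ (ListP.map-id p)))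

    -P_ : Poly v → Poly v
    -P p = map (λ t → (- proj₁ t , proj₂ t)) p

    coeff-neg : ∀ (p : Poly v) α → coeff (-P p) α ≈ - coeff p α
    coeff-neg p α = begin
      coeff (-P p) α                                 ≈⟨ coeff-map _ p α ⟩
      ∑ p (λ t → δ (proj₂ t) α (- proj₁ t))          ≈⟨ ∑-cong p (λ t → δ-neg (proj₂ t) α (proj₁ t)) ⟩
      ∑ p (λ t → - δ (proj₂ t) α (proj₁ t))          ≈⟨ ∑-neg p _ ⟩
      - ∑ p (λ t → δ (proj₂ t) α (proj₁ t))          ≈⟨ -‿cong (coeff-∑ p α) ⟨
      - coeff p α                                    ∎

    +P-comm : (p q : Poly v) → p +P q ≋ q +P p
    +P-comm p q = coeffwise λ α → trans (coeff-++ p q α) (trans (+-comm _ _) (sym (coeff-++ q p α)))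

    -P-cong : {p q : Poly v} → p ≋ q → -P p ≋ -P q
    -P-cong {p} {q} p≋q = coeffwise λ α → trans (coeff-neg p α) (trans (-‿cong (coeff-≈ p≋q α)) (sym (coeff-neg q α)))

    -P-inverseˡ : (p : Poly v) → (-P p) +P p ≋ 0P
    -P-inverseˡ p = coeffwise λ α → trans (coeff-++ (-P p) p α) (trans (+-congʳ (coeff-neg p α)) (-‿inverseˡ _))

    -P-inverseʳ : (p : Poly v) → p +P (-P p) ≋ 0P
    -P-inverseʳ p = ≋-trans (+P-comm p (-P p)) (-P-inverseˡ p)

  polynomialRing : ℕ → CommutativeRing c ℓ
  polynomialRing v = record
    { Carrier = Poly v ; _≈_ = _≋_ ; _+_ = _+P_ ; _*_ = _*P_ ; -_ = -P_ ; 0# = 0P ; 1# = 1P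
    ; isCommutativeRing = record
      { isRing = record
        { +-isAbelianGroup = record
          { isGroup = record
            { isMonoid = record
              { isSemigroup = record
                { isMagma = record
                  { isEquivalence = record { refl = ≋-refl ; sym = ≋-sym ; trans = ≋-trans }
                  ; ∙-cong = +P-cong }
                ; assoc = λ p q r → ≡⇒≋ (ListP.++-assoc p q r) }
              ; identity = (λ p → ≋-refl) , +P-identityʳ }
            ; inverse = -P-inverseˡ , -P-inverseʳ
            ; ⁻¹-cong = -P-cong }
          ; comm = +P-comm }
        ; *-cong = *P-cong
        ; *-assoc = *P-assoc
        ; *-identity = *P-identityˡ , (λ p → ≋-trans (*P-comm p 1P) (*P-identityˡ p))
        ; distrib = *P-distribˡ , *P-distribʳ }
      ; *-comm = *P-comm } }

module TermFamilies {c ℓ} (K : CommutativeRing c ℓ) where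
  open Defs.PolyDefs K using (Monomial; Poly; coeff)
  open Polynomials K
  open ListSums K
  private module Kᵣ = CommutativeRing K
  open Kᵣ using (Carrier; 0#; 1#; _≈_)

  module _ {v : ℕ} where
    private module Pᵣ = CommutativeRing (polynomialRing v)
    open Pᵣ using (_+_; _*_; -_; _-_)
    open ListSums (polynomialRing v) using () renaming (∑ to ∑ₚ)

    single : Carrier → Monomial v → Poly v
    single a β = (a , β) ∷ []

    const : Carrier → Poly v
    const a = single a (Vec.replicate v 0)

    coeff-single : ∀ a β α → coeff (single a β) α ≈ δ β α a
    coeff-single a β α = Kᵣ.trans (coeff-∷ a β [] α) (Kᵣ.+-identityʳ _)

    coeff-const* : ∀ a p α → coeff (const a * p) α ≈ a Kᵣ.* coeff p α
    coeff-const* a p α = Kᵣ.trans (coeff-* (const a) p α) (Kᵣ.trans (Kᵣ.+-identityʳ _) (Kᵣ.*-congˡ (shifted-0 p α)))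
      where
      shifted-0 : ∀ p α → shifted (Vec.replicate v 0) p α ≈ coeff p α
      shifted-0 p α with Vec.replicate v 0 ⊕ (α ⊖ Vec.replicate v 0) ≟ₘ α
      ... | yes _ = Kᵣ.reflexive (≡.cong (coeff p) (⊖-identityʳ α))
      ... | no ≢α = contradiction (≡.trans (⊕-identityˡ _) (⊖-identityʳ α)) ≢α

    single-cong : ∀ {a b} β → a ≈ b → single a β ≋ single b β
    single-cong β a≈b = coeffwise λ α → Kᵣ.trans (coeff-single _ β α) (Kᵣ.trans (δ-cong β α a≈b) (Kᵣ.sym (coeff-single _ β α)))

    single≋const*single : ∀ a β → single a β ≋ const a * single 1# β
    single≋const*single a β = coeffwise λ α → Kᵣ.sym (begin
      coeff (const a * single 1# β) α    ≈⟨ coeff-const* a (single 1# β) α ⟩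
      a Kᵣ.* coeff (single 1# β) α       ≈⟨ Kᵣ.*-congˡ (coeff-single 1# β α) ⟩
      a Kᵣ.* δ β α 1#                    ≈⟨ δ-*ˡ β α a 1# ⟨
      δ β α (a Kᵣ.* 1#)                  ≈⟨ δ-cong β α (Kᵣ.*-identityʳ a) ⟩
      δ β α a                            ≈⟨ coeff-single a β α ⟨
      coeff (single a β) α               ∎)
      where open import Relation.Binary.Reasoning.Setoid Kᵣ.setoid

    single-nonzero : ∀ {a} β → ¬ a ≈ 0# → ¬ single a β ≋ []
    single-nonzero {a} β a≉0 a≈0 = a≉0 (begin
      a                         ≈⟨ δ-≡ {β = β} {α = β} a ≡.refl ⟨
      δ β β a                   ≈⟨ coeff-single a β β ⟨
      coeff (single a β) β      ≈⟨ coeff-≈ a≈0 β ⟩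
      0#                        ∎)
      where open import Relation.Binary.Reasoning.Setoid Kᵣ.setoid

    single*single : ∀ a b β γ → single a β * single b γ ≋ single (a Kᵣ.* b) (β ⊕ γ)
    single*single a b β γ = +P-identityʳ (single (a Kᵣ.* b) (β ⊕ γ))

    -- Every steady-state polynomial ẋ_s has this form.
    indexed : ∀ {m} → (Fin m → Carrier) → (Fin m → Monomial v) → Poly v
    indexed {m} f μ = map (λ j → (f j , μ j)) (allFin m)

    module _ {m : ℕ} where

      coeff-indexed : ∀ f μ α → coeff (indexed {m} f μ) α ≈ ∑ (allFin m) (λ j → δ (μ j) α (f j))
      coeff-indexed f μ α = coeff-map _ (allFin m) α

      indexed-zero : ∀ f μ → (∀ j → f j ≈ 0#) → indexed {m} f μ ≋ []
      indexed-zero f μ f≈0 = coeffwise λ α →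
        Kᵣ.trans (coeff-indexed f μ α) (∑-zero (allFin m) (λ j → Kᵣ.trans (δ-cong (μ j) α (f≈0 j)) (δ-0 (μ j) α)))

      indexed-onlyAt : ∀ i f μ → (∀ j → j ≢ i → f j ≈ 0#) → indexed {m} f μ ≋ single (f i) (μ i)
      indexed-onlyAt i f μ f≈0 = coeffwise λ α → Kᵣ.trans (coeff-indexed f μ α) (Kᵣ.trans
        (∑-allFin-onlyAt i _ (λ j j≢i → Kᵣ.trans (δ-cong (μ j) α (f≈0 j j≢i)) (δ-0 (μ j) α)))
        (Kᵣ.sym (coeff-single (f i) (μ i) α)))

      indexed-exceptAt : ∀ i f g μ ν → (∀ j → j ≢ i → f j ≈ g j × μ j ≡ ν j) →
                         indexed {m} f μ ≋ indexed g ν + (single (f i) (μ i) - single (g i) (ν i))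
      indexed-exceptAt i f g μ ν agree = ≋-sym (coeffwise λ α → begin
        coeff (indexed g ν + (single (f i) (μ i) - single (g i) (ν i))) α
          ≈⟨ coeff-++ (indexed g ν) _ α ⟩
        coeff (indexed g ν) α Kᵣ.+ coeff (single (f i) (μ i) - single (g i) (ν i)) α
          ≈⟨ Kᵣ.+-congˡ (coeff-++ (single (f i) (μ i)) _ α) ⟩
        coeff (indexed g ν) α Kᵣ.+ (coeff (single (f i) (μ i)) α Kᵣ.+ coeff (- single (g i) (ν i)) α)
          ≈⟨ Kᵣ.+-cong (coeff-indexed g ν α) (Kᵣ.+-cong (coeff-single (f i) (μ i) α)
               (Kᵣ.trans (coeff-neg (single (g i) (ν i)) α) (Kᵣ.-‿cong (coeff-single (g i) (ν i) α)))) ⟩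
        ∑ (allFin m) (λ j → δ (ν j) α (g j)) Kᵣ.+ (δ (μ i) α (f i) Kᵣ.- δ (ν i) α (g i))
          ≈⟨ ∑-allFin-exceptAt i _ _ (λ j j≢i → same j j≢i) ⟨
        ∑ (allFin m) (λ j → δ (μ j) α (f j))
          ≈⟨ coeff-indexed f μ α ⟨
        coeff (indexed f μ) α ∎)
        where
        open import Relation.Binary.Reasoning.Setoid Kᵣ.setoid
        same : ∀ j → j ≢ i → ∀ {α} → δ (μ j) α (f j) ≈ δ (ν j) α (g j)
        same j j≢i {α} with f≈g , μ≡ν ← agree j j≢i =
          Kᵣ.trans (δ-cong (μ j) α f≈g) (Kᵣ.reflexive (≡.cong (λ β → δ β α (g j)) μ≡ν))

      coeff-∑ₚ : ∀ {a} {A : Set a} (xs : List A) (F : A → Poly v) α → coeff (∑ₚ xs F) α ≈ ∑ xs (λ x → coeff (F x) α)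
      coeff-∑ₚ []       F α = Kᵣ.refl
      coeff-∑ₚ (x ∷ xs) F α = Kᵣ.trans (coeff-++ (F x) _ α) (Kᵣ.+-congˡ (coeff-∑ₚ xs F α))

      ∑-const*-indexed : ∀ {a} {A : Set a} (xs : List A) (c : A → Carrier) (w : A → Fin m → Carrier) μ →
                         ∑ₚ xs (λ s → const (c s) * indexed (w s) μ) ≋ indexed (λ j → ∑ xs (λ s → c s Kᵣ.* w s j)) μ
      ∑-const*-indexed xs c w μ = coeffwise λ α → begin
        coeff (∑ₚ xs (λ s → const (c s) * indexed (w s) μ)) α           ≈⟨ coeff-∑ₚ xs _ α ⟩
        ∑ xs (λ s → coeff (const (c s) * indexed (w s) μ) α)
          ≈⟨ ∑-cong xs (λ s → Kᵣ.trans (coeff-const* (c s) (indexed (w s) μ) α) (Kᵣ.*-congˡ (coeff-indexed (w s) μ α))) ⟩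
        ∑ xs (λ s → c s Kᵣ.* ∑ (allFin m) (λ j → δ (μ j) α (w s j)))   ≈⟨ ∑-cong xs (λ s → ∑-*ˡ (allFin m) (c s) _) ⟨
        ∑ xs (λ s → ∑ (allFin m) (λ j → c s Kᵣ.* δ (μ j) α (w s j)))   ≈⟨ ∑-swap xs (allFin m) _ ⟩
        ∑ (allFin m) (λ j → ∑ xs (λ s → c s Kᵣ.* δ (μ j) α (w s j)))
          ≈⟨ ∑-cong (allFin m) (λ j → ∑-cong xs (λ s → δ-*ˡ (μ j) α (c s) (w s j))) ⟨
        ∑ (allFin m) (λ j → ∑ xs (λ s → δ (μ j) α (c s Kᵣ.* w s j)))   ≈⟨ ∑-cong (allFin m) (λ j → δ-∑ (μ j) α xs _) ⟨
        ∑ (allFin m) (λ j → δ (μ j) α (∑ xs (λ s → c s Kᵣ.* w s j)))   ≈⟨ coeff-indexed _ μ α ⟨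
        coeff (indexed (λ j → ∑ xs (λ s → c s Kᵣ.* w s j)) μ) α        ∎
        where open import Relation.Binary.Reasoning.Setoid Kᵣ.setoid

module NonzeroProducts {c ℓ} (K : CommutativeRing c ℓ) (FK : IsFieldChar0 K) where
  open CommutativeRing K
  open Defs.PolyDefs K using (Monomial; Poly; coeff; 0P; 1P; _*P_)
  open Polynomials K
  open TermFamilies K using (single-nonzero)
  open ListSums K
  open IntegerRingSolver K
  import Data.Vec.Relation.Binary.Lex.Strict as Lex
  open import Data.Vec.Relation.Binary.Pointwise.Inductive using (Pointwise-≡⇒≡; ≡⇒Pointwise-≡)
  open import Relation.Nullary.Decidable using (¬?; ¬¬-excluded-middle)
  open import Relation.Binary.Definitions using (tri<; tri≈; tri>)
  open import Relation.Binary.Structures using (IsEquivalence)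
  open import Relation.Binary.Reasoning.Setoid setoid

  *-nonzero : ∀ {a b} → ¬ a ≈ 0# → ¬ b ≈ 0# → ¬ a * b ≈ 0#
  *-nonzero {a} {b} a≉0 b≉0 ab≈0 with a⁻¹ , aa⁻¹≈1 ← IsFieldChar0.inverse FK a a≉0 = b≉0 (begin
    b               ≈⟨ *-identityˡ b ⟨
    1# * b          ≈⟨ *-congʳ aa⁻¹≈1 ⟨
    a * a⁻¹ * b     ≈⟨ solve 3 (λ a a⁻¹ b → a :* a⁻¹ :* b := a⁻¹ :* (a :* b)) refl a a⁻¹ b ⟩
    a⁻¹ * (a * b)   ≈⟨ *-congˡ ab≈0 ⟩
    a⁻¹ * 0#        ≈⟨ zeroʳ a⁻¹ ⟩
    0#              ∎)

  1P≉0P : ∀ {v} → ¬ 1P {v} ≋ 0P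
  1P≉0P = single-nonzero (Vec.replicate _ 0) (IsFieldChar0.one≉zero FK)

  infix 4 _<ₗ_ _≤ₗ_
  _<ₗ_ : ∀ {v} → Monomial v → Monomial v → Set
  _<ₗ_ = Lex.Lex-< _≡_ ℕ._<_

  _≤ₗ_ : ∀ {v} → Monomial v → Monomial v → Set
  β ≤ₗ γ = β ≡ γ ⊎ β <ₗ γ

  module _ {v : ℕ} where

    <ₗ-irrefl : {β : Monomial v} → ¬ β <ₗ β
    <ₗ-irrefl = Lex.<-irrefl ℕP.<-irrefl (≡⇒Pointwise-≡ ≡.refl)

    <ₗ-trans : {β γ μ : Monomial v} → β <ₗ γ → γ <ₗ μ → β <ₗ μ
    <ₗ-trans = Lex.<-trans (IsEquivalence.isPartialEquivalence ≡.isEquivalence) (≡.resp₂ ℕ._<_) ℕP.<-trans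

    <ₗ-≤ₗ-trans : {β γ μ : Monomial v} → β <ₗ γ → γ ≤ₗ μ → β <ₗ μ
    <ₗ-≤ₗ-trans β<γ (inj₁ ≡.refl) = β<γ
    <ₗ-≤ₗ-trans β<γ (inj₂ γ<μ)    = <ₗ-trans β<γ γ<μ

    ≤ₗ-trans : {β γ μ : Monomial v} → β ≤ₗ γ → γ ≤ₗ μ → β ≤ₗ μ
    ≤ₗ-trans (inj₁ ≡.refl) γ≤μ = γ≤μ
    ≤ₗ-trans (inj₂ β<γ)    γ≤μ = inj₂ (<ₗ-≤ₗ-trans β<γ γ≤μ)

  <ₗ-⊕ʳ : ∀ {v} {β γ : Monomial v} μ → β <ₗ γ → β ⊕ μ <ₗ γ ⊕ μ
  <ₗ-⊕ʳ (z ∷ μ) (Lex.this x<y ≡.refl) = Lex.this (ℕP.+-monoˡ-< z x<y) ≡.refl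
  <ₗ-⊕ʳ (z ∷ μ) (Lex.next x≡y β<γ)    = Lex.next (≡.cong (ℕ._+ z) x≡y) (<ₗ-⊕ʳ μ β<γ)

  <ₗ-⊕ˡ : ∀ {v} {β γ : Monomial v} μ → β <ₗ γ → μ ⊕ β <ₗ μ ⊕ γ
  <ₗ-⊕ˡ {β = β} {γ} μ β<γ = ≡.subst₂ _<ₗ_ (⊕-comm β μ) (⊕-comm γ μ) (<ₗ-⊕ʳ μ β<γ)

  ⊕-≤ₗ-equal : ∀ {v} {β β* γ γ* : Monomial v} →
               β ≤ₗ β* → γ ≤ₗ γ* → β ⊕ γ ≡ β* ⊕ γ* → β ≡ β* × γ ≡ γ*
  ⊕-≤ₗ-equal (inj₁ β≡β*) (inj₁ γ≡γ*) _ = β≡β* , γ≡γ*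
  ⊕-≤ₗ-equal {β = β} (inj₁ ≡.refl) (inj₂ γ<γ*) eq =
    contradiction (≡.subst (_<ₗ _) eq (<ₗ-⊕ˡ β γ<γ*)) <ₗ-irrefl
  ⊕-≤ₗ-equal {β* = β*} {γ} (inj₂ β<β*) γ≤γ* eq =
    contradiction (≡.subst (_<ₗ _) eq (<ₗ-≤ₗ-trans (<ₗ-⊕ʳ γ β<β*) (Sum.map (≡.cong (β* ⊕_)) (<ₗ-⊕ˡ β*) γ≤γ*)))
                  <ₗ-irrefl

  _⊔ₗ_ : ∀ {v} → Monomial v → Monomial v → Monomial v
  β ⊔ₗ γ with Lex.<-cmp ≡.sym ℕP.<-cmp β γ
  ... | tri< _ _ _ = γ
  ... | tri≈ _ _ _ = β
  ... | tri> _ _ _ = β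

  module _ {v} (β γ : Monomial v) where

    ≤ₗ-⊔ₗˡ : β ≤ₗ β ⊔ₗ γ
    ≤ₗ-⊔ₗˡ with Lex.<-cmp ≡.sym ℕP.<-cmp β γ
    ... | tri< β<γ _ _ = inj₂ β<γ
    ... | tri≈ _ _ _   = inj₁ ≡.refl
    ... | tri> _ _ _   = inj₁ ≡.refl

    ≤ₗ-⊔ₗʳ : γ ≤ₗ β ⊔ₗ γ
    ≤ₗ-⊔ₗʳ with Lex.<-cmp ≡.sym ℕP.<-cmp β γ
    ... | tri< _ _ _   = inj₁ ≡.refl
    ... | tri≈ _ β≈γ _ = inj₁ (≡.sym (Pointwise-≡⇒≡ β≈γ))
    ... | tri> _ _ γ<β = inj₂ γ<β

    ⊔ₗ-sel : β ⊔ₗ γ ≡ β ⊎ β ⊔ₗ γ ≡ γ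
    ⊔ₗ-sel with Lex.<-cmp ≡.sym ℕP.<-cmp β γ
    ... | tri< _ _ _ = inj₂ ≡.refl
    ... | tri≈ _ _ _ = inj₁ ≡.refl
    ... | tri> _ _ _ = inj₁ ≡.refl

  maxMonomial : ∀ {v} → Term v → Poly v → Monomial v
  maxMonomial t p = List.foldr (λ s μ → proj₂ s ⊔ₗ μ) (proj₂ t) p

  maxMonomial-bound : ∀ {v} (t : Term v) p → All (λ s → proj₂ s ≤ₗ maxMonomial t p) (t ∷ p)
  maxMonomial-bound t []      = inj₁ ≡.refl ∷ []
  maxMonomial-bound t (s ∷ p) with bound-t ∷ bound-p ← maxMonomial-bound t p =
    ≤ₗ-trans bound-t raise ∷ ≤ₗ-⊔ₗˡ (proj₂ s) _ ∷ All.map (λ b → ≤ₗ-trans b raise) bound-p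
    where raise = ≤ₗ-⊔ₗʳ (proj₂ s) (maxMonomial t p)

  maxMonomial-attained : ∀ {v} (t : Term v) p → Any (λ s → proj₂ s ≡ maxMonomial t p) (t ∷ p)
  maxMonomial-attained t []      = here ≡.refl
  maxMonomial-attained t (s ∷ p) with ⊔ₗ-sel (proj₂ s) (maxMonomial t p)
  ... | inj₁ ≡s = there (here (≡.sym ≡s))
  ... | inj₂ ≡m with maxMonomial-attained t p
  ...   | here ≡t  = here (≡.trans ≡t (≡.sym ≡m))
  ...   | there ≡p = there (there (Any.map (λ e → ≡.trans e (≡.sym ≡m)) ≡p))

  δ-⊕-maximal : ∀ {v} {β β* γ γ* : Monomial v} a b → β ≤ₗ β* → γ ≤ₗ γ* →
                δ (β ⊕ γ) (β* ⊕ γ*) (a * b) ≈ δ β β* a * δ γ γ* b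
  δ-⊕-maximal {β = β} {β*} {γ} {γ*} a b β≤β* γ≤γ* with β ⊕ γ ≟ₘ β* ⊕ γ*
  ... | yes eq with β≡β* , γ≡γ* ← ⊕-≤ₗ-equal β≤β* γ≤γ* eq = sym (*-cong (δ-≡ a β≡β*) (δ-≡ b γ≡γ*))
  ... | no neq with β ≟ₘ β*
  ...   | no  β≢β* = sym (zeroˡ _)
  ...   | yes β≡β* = sym (trans (*-congˡ (δ-≢ b λ γ≡γ* → neq (≡.cong₂ _⊕_ β≡β* γ≡γ*))) (zeroʳ _))

  coeff-*-leading : ∀ {v} (p q : Poly v) (β* γ* : Monomial v) →
                    All (λ t → proj₂ t ≤ₗ β*) p → All (λ t → proj₂ t ≤ₗ γ*) q →
                    coeff (p *P q) (β* ⊕ γ*) ≈ coeff p β* * coeff q γ*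
  coeff-*-leading p q β* γ* p≤β* q≤γ* = begin
    coeff (p *P q) (β* ⊕ γ*)                                                   ≈⟨ coeff-*-∑∑ p q _ ⟩
    ∑ p (λ t → ∑ q (λ s → δ (proj₂ t ⊕ proj₂ s) (β* ⊕ γ*) (proj₁ t * proj₁ s)))
        ≈⟨ ∑-congᴬ p≤β* (λ t t≤ → ∑-congᴬ q≤γ* (λ s s≤ → δ-⊕-maximal (proj₁ t) (proj₁ s) t≤ s≤)) ⟩
    ∑ p (λ t → ∑ q (λ s → δ (proj₂ t) β* (proj₁ t) * δ (proj₂ s) γ* (proj₁ s))) ≈⟨ ∑-cong p (λ t → ∑-*ˡ q _ _) ⟩
    ∑ p (λ t → δ (proj₂ t) β* (proj₁ t) * ∑ q (λ s → δ (proj₂ s) γ* (proj₁ s))) ≈⟨ ∑-*ʳ p _ _ ⟩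
    ∑ p (λ t → δ (proj₂ t) β* (proj₁ t)) * ∑ q (λ s → δ (proj₂ s) γ* (proj₁ s)) ≈⟨ *-cong (coeff-∑ p β*) (coeff-∑ q γ*) ⟨
    coeff p β* * coeff q γ*                                                    ∎

  dropMonomial : ∀ {v} → Monomial v → Poly v → Poly v
  dropMonomial β = List.filter (λ t → ¬? (proj₂ t ≟ₘ β))

  module _ {v} (β : Monomial v) where

    coeff-dropMonomial-≢ : ∀ p {α} → α ≢ β → coeff (dropMonomial β p) α ≈ coeff p α
    coeff-dropMonomial-≢ []            α≢β = refl
    coeff-dropMonomial-≢ ((a , γ) ∷ p) {α} α≢β with γ ≟ₘ β
    ... | yes ≡.refl = begin
      coeff (dropMonomial β p) α    ≈⟨ coeff-dropMonomial-≢ p α≢β ⟩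
      coeff p α                     ≈⟨ +-identityˡ _ ⟨
      0# + coeff p α                ≈⟨ +-congʳ (δ-≢ a (α≢β ∘ ≡.sym)) ⟨
      δ β α a + coeff p α           ≈⟨ coeff-∷ a β p α ⟨
      coeff ((a , β) ∷ p) α         ∎
    ... | no _ = trans (coeff-∷ a γ _ α) (trans (+-congˡ (coeff-dropMonomial-≢ p α≢β)) (sym (coeff-∷ a γ p α)))

    coeff-dropMonomial-≡ : ∀ p → coeff (dropMonomial β p) β ≈ 0#
    coeff-dropMonomial-≡ []            = refl
    coeff-dropMonomial-≡ ((a , γ) ∷ p) with γ ≟ₘ β
    ... | yes ≡.refl = coeff-dropMonomial-≡ p
    ... | no γ≢β = trans (coeff-∷ a γ _ β) (trans (+-cong (δ-≢ a γ≢β) (coeff-dropMonomial-≡ p)) (+-identityˡ 0#))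

    dropMonomial-≋ : ∀ p → coeff p β ≈ 0# → p ≋ dropMonomial β p
    dropMonomial-≋ p p[β]≈0 = coeffwise λ α → case-α α
      where
      case-α : ∀ α → coeff p α ≈ coeff (dropMonomial β p) α
      case-α α with α ≟ₘ β
      ... | yes ≡.refl = trans p[β]≈0 (sym (coeff-dropMonomial-≡ p))
      ... | no  α≢β    = sym (coeff-dropMonomial-≢ p α≢β)

    dropMonomial-shorter : ∀ p → Any (λ t → proj₂ t ≡ β) p → length (dropMonomial β p) ℕ.< length p
    dropMonomial-shorter p β∈p = ListP.filter-notAll (λ t → ¬? (proj₂ t ≟ₘ β)) p (Any.map (λ e ne → ne e) β∈p)

  -- Induction on the number of terms: a vanishing leading (lexicographically largest) coefficient is dropped;
  -- otherwise the coefficient of p q at the sum of the leading monomials is the nonzero product of the leading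
  -- coefficients. Coefficient equality is undecidable, but the goal is a negation, so excluded middle is available.
  *P-nonzero : ∀ {v} (p q : Poly v) → ¬ p ≋ 0P → ¬ q ≋ 0P → ¬ (p *P q) ≋ 0P
  *P-nonzero p q = bounded (suc (length p ℕ.+ length q)) p q ℕP.≤-refl
    where
    bounded : ∀ {v} N (p q : Poly v) → length p ℕ.+ length q ℕ.< N → ¬ p ≋ 0P → ¬ q ≋ 0P → ¬ (p *P q) ≋ 0P
    bounded N       []      q       _       p≉0 _   _ = p≉0 ≋-refl
    bounded N       (t ∷ p) []      _       _   q≉0 _ = q≉0 ≋-refl
    bounded (suc N) (t ∷ p) (w ∷ q) (s≤s len) p≉0 q≉0 pq≈0 =
      ¬¬-excluded-middle λ
      { (yes p[β*]≈0) → bounded N (dropMonomial β* (t ∷ p)) (w ∷ q)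
          (ℕP.<-≤-trans (ℕP.+-monoˡ-< (length (w ∷ q)) (dropMonomial-shorter β* (t ∷ p) (maxMonomial-attained t p))) len)
          (λ p'≈0 → p≉0 (≋-trans (dropMonomial-≋ β* (t ∷ p) p[β*]≈0) p'≈0)) q≉0
          (≋-trans (*P-congʳ (w ∷ q) (≋-sym (dropMonomial-≋ β* (t ∷ p) p[β*]≈0))) pq≈0)
      ; (no p[β*]≉0) → ¬¬-excluded-middle λ
        { (yes q[γ*]≈0) → bounded N (t ∷ p) (dropMonomial γ* (w ∷ q))
            (ℕP.<-≤-trans (ℕP.+-monoʳ-< (length (t ∷ p)) (dropMonomial-shorter γ* (w ∷ q) (maxMonomial-attained w q))) len)
            p≉0 (λ q'≈0 → q≉0 (≋-trans (dropMonomial-≋ γ* (w ∷ q) q[γ*]≈0) q'≈0))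
            (≋-trans (*P-congˡ (t ∷ p) (≋-sym (dropMonomial-≋ γ* (w ∷ q) q[γ*]≈0))) pq≈0)
        ; (no q[γ*]≉0) → *-nonzero p[β*]≉0 q[γ*]≉0 (trans
            (sym (coeff-*-leading (t ∷ p) (w ∷ q) β* γ* (maxMonomial-bound t p) (maxMonomial-bound w q)))
            (coeff-≈ pq≈0 (β* ⊕ γ*))) } }
      where
      β* = maxMonomial t p
      γ* = maxMonomial w q

module RationalCombinations {c ℓ} (K : CommutativeRing c ℓ) (FK : IsFieldChar0 K) where
  open Defs.PolyDefs K using (Poly; Vars; InKappa; RatPoly; _/_∣_,_; lincomb; _⊆Ideal_)
  open Polynomials K using (Term; _≋_; coeffwise; coeff-≈; polynomialRing)
  open NonzeroProducts K FK using (*P-nonzero; 1P≉0P)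
  open import Data.Fin using (_↑ʳ_)
  import Data.List.Relation.Unary.All.Properties as AllP

  module _ {m n : ℕ} where
    private
      V = Vars m n
      open CommutativeRing (polynomialRing V)
    open LinearCombinations (polynomialRing V)
    open IntegerRingSolver (polynomialRing V)
    open import Relation.Binary.Reasoning.Setoid setoid

    InKappa-* : ∀ p q → InKappa m n p → InKappa m n q → InKappa m n (p * q)
    InKappa-* []      q []        q∈K[κ] = []
    InKappa-* (t ∷ p) q (t∈ ∷ p∈) q∈K[κ] =
      AllP.++⁺ (AllP.map⁺ (All.map (λ {w} → scaled {w}) q∈K[κ])) (InKappa-* p q p∈ q∈K[κ])
      where
      scaled : ∀ {w : Term V} → (∀ s → lookup (proj₂ w) (suc m ↑ʳ s) ≡ 0) →
               ∀ s → lookup (Vec.zipWith ℕ._+_ (proj₂ t) (proj₂ w)) (suc m ↑ʳ s) ≡ 0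
      scaled {w} w∈ s = ≡.trans (VecP.lookup-zipWith ℕ._+_ (suc m ↑ʳ s) (proj₂ t) (proj₂ w)) (≡.cong₂ ℕ._+_ (t∈ s) (w∈ s))

    InKappa-1 : InKappa m n 1#
    InKappa-1 = (λ s → VecP.lookup-replicate (suc m ↑ʳ s) 0) ∷ []

    lincomb-den-InKappa : ∀ (cs : List (RatPoly m n)) fs → InKappa m n (proj₂ (lincomb cs fs))
    lincomb-den-InKappa []       fs       = InKappa-1
    lincomb-den-InKappa (c ∷ cs) []       = InKappa-1
    lincomb-den-InKappa (c ∷ cs) (f ∷ fs) = InKappa-* (RatPoly.den c) _ (RatPoly.den-κ c) (lincomb-den-InKappa cs fs)

    lincomb-den-nonzero : ∀ (cs : List (RatPoly m n)) fs → ¬ proj₂ (lincomb cs fs) ≈ 0#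
    lincomb-den-nonzero []       fs       = 1P≉0P
    lincomb-den-nonzero (c ∷ cs) []       = 1P≉0P
    lincomb-den-nonzero (c ∷ cs) (f ∷ fs) =
      *P-nonzero (RatPoly.den c) _ (RatPoly.den-≉0 c ∘ coeff-≈) (lincomb-den-nonzero cs fs)

    lincomb-num-∈Span : ∀ {gs} T (cs : List (RatPoly m n)) fs →
                        All (λ f → f * T ∈Span gs) fs → proj₁ (lincomb cs fs) * T ∈Span gs
    lincomb-num-∈Span {gs} T []       fs       _            = 0∈Span gs
    lincomb-num-∈Span {gs} T (c ∷ cs) []       _            = 0∈Span gs
    lincomb-num-∈Span {gs} T (c ∷ cs) (f ∷ fs) (fT∈ ∷ fsT∈) =
      ∈Span-resp-≈ regroup (∈Span-+ (∈Span-*ˡ (a * proj₂ L) fT∈) (∈Span-*ˡ d (lincomb-num-∈Span T cs fs fsT∈)))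
      where
      L = lincomb cs fs
      a = RatPoly.num c
      d = RatPoly.den c
      regroup : a * proj₂ L * (f * T) + d * (proj₁ L * T) ≈ (a * f * proj₂ L + proj₁ L * d) * T
      regroup = solve 6 (λ a b f T d l → a :* b :* (f :* T) :+ d :* (l :* T) := (a :* f :* b :+ l :* d) :* T)
                  refl a (proj₂ L) f T d (proj₁ L)

    module _ (E : Poly V) (E∈K[κ] : InKappa m n E) (E≉0 : ¬ E ≈ 0#) where

      over : Poly V → RatPoly m n
      over C = C / E ∣ E∈K[κ] , (E≉0 ∘ coeffwise)

      -- Stated for an arbitrary fraction a / b so that the induction never has to cancel E:
      -- with coefficients compared up to ≈, cancellation holds only up to double negation.
      lincomb-over : ∀ C Cs g gs → length Cs ≡ length gs → ∀ a b →
                     a * E ≈ weightedSum (C ∷ Cs) (g ∷ gs) * b →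
                     let L = lincomb (map over (C ∷ Cs)) (g ∷ gs) in a * proj₂ L ≈ proj₁ L * b
      lincomb-over C []        g []        _   a b aE≈ = begin
        a * (E * 1#)                  ≈⟨ *-congˡ {a} (*-identityʳ E) ⟩
        a * E                         ≈⟨ aE≈ ⟩
        (C * g + 0#) * b              ≈⟨ *-congʳ {b} (+-cong (*-identityʳ (C * g)) (zeroˡ E)) ⟨
        (C * g * 1# + 0# * E) * b     ∎
      lincomb-over C (C₂ ∷ Cs) g (g₂ ∷ gs) len a b aE≈ = begin
        a * (E * D)                   ≈⟨ *-assoc a E D ⟨
        a * E * D                     ≈⟨ *-congʳ {D} aE≈ ⟩
        (C * g + S) * b * D           ≈⟨ solve 5 (λ C g S b D → (C :* g :+ S) :* b :* D := C :* g :* D :* b :+ S :* b :* D)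
                                                 refl C g S b D ⟩
        C * g * D * b + S * b * D
          ≈⟨ +-congˡ {C * g * D * b} (lincomb-over C₂ Cs g₂ gs (ℕP.suc-injective len) (S * b) (E * b) SbE≈) ⟩
        C * g * D * b + N * (E * b)
          ≈⟨ solve 6 (λ C g D b N E → C :* g :* D :* b :+ N :* (E :* b) := (C :* g :* D :+ N :* E) :* b)
                                                 refl C g D b N E ⟩
        (C * g * D + N * E) * b       ∎
        where
        S = weightedSum (C₂ ∷ Cs) (g₂ ∷ gs)
        R = lincomb (map over (C₂ ∷ Cs)) (g₂ ∷ gs)
        N = proj₁ R
        D = proj₂ R
        SbE≈ : S * b * E ≈ S * (E * b)
        SbE≈ = solve 3 (λ S b E → S :* b :* E := S :* (E :* b)) refl S b E

    -- h = L / D with L T in the span of gs, so h = (L T) / (D T) is a combination of gs over the denominator D T.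
    ⊆Ideal-fromSpan : ∀ fs gs T → InKappa m n T → ¬ T ≈ 0# → 0 ℕ.< length gs →
                      All (λ f → f * T ∈Span gs) fs → _⊆Ideal_ {m} {n} fs gs
    ⊆Ideal-fromSpan fs (g ∷ gs) T T∈K[κ] T≉0 _ fsT∈ h (cs , len , h≈)
      with lincomb-num-∈Span T cs fs fsT∈
    ... | spanned (C ∷ Cs) lenCs LT≈ =
      map (over E E∈K[κ] E≉0) (C ∷ Cs) , ≡.trans (ListP.length-map _ (C ∷ Cs)) lenCs ,
      coeff-≈ (lincomb-over E E∈K[κ] E≉0 C Cs g gs (ℕP.suc-injective lenCs) a b aE≈)
      where
      L = lincomb cs fs
      E = proj₂ L * T
      E∈K[κ] = InKappa-* (proj₂ L) T (lincomb-den-InKappa cs fs) T∈K[κ]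
      E≉0 = *P-nonzero (proj₂ L) T (lincomb-den-nonzero cs fs) T≉0
      a = RatPoly.num h
      b = RatPoly.den h
      h≈L : a * proj₂ L ≈ proj₁ L * b
      h≈L = coeffwise h≈
      aE≈ : a * E ≈ weightedSum (C ∷ Cs) (g ∷ gs) * b
      aE≈ = begin
        a * (proj₂ L * T)             ≈⟨ *-assoc a (proj₂ L) T ⟨
        a * proj₂ L * T               ≈⟨ *-congʳ {T} h≈L ⟩
        proj₁ L * b * T               ≈⟨ solve 3 (λ l b T → l :* b :* T := l :* T :* b) refl (proj₁ L) b T ⟩
        proj₁ L * T * b               ≈⟨ *-congʳ {b} LT≈ ⟩
        weightedSum (C ∷ Cs) (g ∷ gs) * b ∎

module StoichiometricCombinations {c ℓ} (K : CommutativeRing c ℓ) where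
  open CommutativeRing K
  open Defs using (Complex; IsZeroOne; Multiset; sp; degree; incidence; sumFin; v)
  open import Data.Bool using (if_then_else_)
  open import Relation.Nullary using (does)
  open Defs.FieldDefs K using (natK)
  open ListSums K
  open IntegerRingSolver K
  open import Algebra.Properties.Semiring.Mult semiring using (×-homo-+; ×1-homo-*) renaming (_×_ to _×ℕ_)
  open import Data.Nat.ListAction using () renaming (sum to sumℕ)
  open import Relation.Binary.Reasoning.Setoid setoid

  natK≡×1 : ∀ a → natK a ≡ a ×ℕ 1#
  natK≡×1 zero    = ≡.refl
  natK≡×1 (suc a) = ≡.cong (1# +_) (natK≡×1 a)

  natK-+ : ∀ a b → natK (a ℕ.+ b) ≈ natK a + natK b
  natK-+ a b rewrite natK≡×1 (a ℕ.+ b) | natK≡×1 a | natK≡×1 b = ×-homo-+ 1# a b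

  natK-* : ∀ a b → natK (a ℕ.* b) ≈ natK a * natK b
  natK-* a b rewrite natK≡×1 (a ℕ.* b) | natK≡×1 a | natK≡×1 b = ×1-homo-* a b

  natK-sum : ∀ {a} {A : Set a} (xs : List A) (f : A → ℕ) → natK (sumℕ (map f xs)) ≈ ∑ xs (natK ∘ f)
  natK-sum []       f = refl
  natK-sum (x ∷ xs) f = trans (natK-+ (f x) _) (+-congˡ (natK-sum xs f))

  module _ {n m : ℕ} (y y' : Fin m → Complex n) where

    stoich : Fin n → Fin m → Carrier
    stoich s j = natK (lookup (y' j) s) - natK (lookup (y j) s)

    speciesDegree : Multiset n m → Defs.Vertex m → Carrier
    speciesDegree ℰ w = ∑ (allFin n) (λ s → natK (ℰ (sp s)) * natK (incidence y y' w (sp s)))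

    reactionDegree : Multiset n m → Defs.Vertex m → Carrier
    reactionDegree ℰ w = ∑ (allFin m) (λ l → natK (ℰ (Defs.rx l)) * natK (incidence y y' w (Defs.rx l)))

    natK-degree : ∀ ℰ w → natK (degree y y' ℰ w) ≈ speciesDegree ℰ w + reactionDegree ℰ w
    natK-degree ℰ w = trans (natK-+ (sumFin n _) (sumFin m _)) (+-cong
      (trans (natK-sum (allFin n) _) (∑-cong (allFin n) (λ s → natK-* (ℰ (sp s)) _)))
      (trans (natK-sum (allFin m) _) (∑-cong (allFin m) (λ l → natK-* (ℰ (Defs.rx l)) _))))

    -- The reaction hyperedges meet u j and v j alike and cancel; in a 0,1-network the incidences with
    -- species hyperedges are the stoichiometric coefficients.
    degree-v-u : IsZeroOne y y' → ∀ ℰ j →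
                 natK (degree y y' ℰ (v j)) - natK (degree y y' ℰ (u j))
                 ≈ ∑ (allFin n) (λ s → natK (ℰ (sp s)) * stoich s j)
    degree-v-u zeroOne ℰ j = begin
      natK (degree y y' ℰ (v j)) - natK (degree y y' ℰ (u j))
        ≈⟨ +-cong (natK-degree ℰ (v j)) (-‿cong (natK-degree ℰ (u j))) ⟩
      (speciesDegree ℰ (v j) + reactionDegree ℰ (u j)) - (speciesDegree ℰ (u j) + reactionDegree ℰ (u j))
        ≈⟨ solve 3 (λ a b r → (a :+ r) :- (b :+ r) := a :- b) refl _ _ (reactionDegree ℰ (u j)) ⟩
      speciesDegree ℰ (v j) - speciesDegree ℰ (u j)
        ≈⟨ +-congˡ (∑-neg (allFin n) _) ⟨
      speciesDegree ℰ (v j) + ∑ (allFin n) (λ s → - (natK (ℰ (sp s)) * natK (incidence y y' (u j) (sp s))))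
        ≈⟨ ∑-+ (allFin n) _ _ ⟨
      ∑ (allFin n) (λ s → natK (ℰ (sp s)) * natK (incidence y y' (v j) (sp s))
                          - natK (ℰ (sp s)) * natK (incidence y y' (u j) (sp s)))
        ≈⟨ ∑-cong (allFin n) (λ s → trans (solve 3 (λ e a b → e :* a :- e :* b := e :* (a :- b)) refl _ _ _)
             (*-congˡ (reflexive (≡.cong₂ (λ a b → natK a - natK b) (incidence-v s) (incidence-u s))))) ⟩
      ∑ (allFin n) (λ s → natK (ℰ (sp s)) * stoich s j) ∎
      where
      zeroOneIndicator : ∀ a → a ℕ.≤ 1 → (if does (a ℕP.≟ 0) then 0 else 1) ≡ a
      zeroOneIndicator zero          _         = ≡.refl
      zeroOneIndicator (suc zero)    _         = ≡.refl
      zeroOneIndicator (suc (suc a)) (s≤s ())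
      incidence-u : ∀ s → incidence y y' (u j) (sp s) ≡ lookup (y j) s
      incidence-u s = zeroOneIndicator _ (proj₁ (zeroOne j s))
      incidence-v : ∀ s → incidence y y' (v j) (sp s) ≡ lookup (y' j) s
      incidence-v s = zeroOneIndicator _ (proj₂ (zeroOne j s))

module SteadyStateGenerators {c ℓ} (K : CommutativeRing c ℓ) where
  open CommutativeRing K using (0#; _≈_; _-_; -‿inverseʳ; trans; reflexive)
  open Defs.FieldDefs K using (natK)
  open StoichiometricCombinations K using (stoich)
  open Defs using (Complex; InSpecies; inSpecies?; zeroC)
  open Defs.PolyDefs K using (Vars)
  open Defs.SteadyState K using (ssPoly)
  open Polynomials K using (polynomialRing; ≋-sym)
  open TermFamilies K using (indexed-zero)
  open import Data.List.Membership.Propositional.Properties using (∈-allFin; ∈-filter⁺; ∈-map⁺)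

  module _ {n m : ℕ} (rate : Fin m → Fin (suc m)) (y y' : Fin m → Complex n) where
    open LinearCombinations (polynomialRing (Vars m n))

    notInSpecies : ∀ {s} → ¬ InSpecies y y' s → ∀ j → lookup (y j) s ≡ 0 × lookup (y' j) s ≡ 0
    notInSpecies {s} s∉𝒮 j with lookup (y j) s ℕP.≟ 0 | lookup (y' j) s ℕP.≟ 0
    ... | yes ≡0 | yes ≡0' = ≡0 , ≡0'
    ... | no  ≢0 | _       = contradiction (j , inj₁ ≢0) s∉𝒮
    ... | yes _  | no  ≢0  = contradiction (j , inj₂ ≢0) s∉𝒮

    ssPoly-∈Span : ∀ s → ssPoly rate y y' s ∈Span ssGenerators K rate y y'
    ssPoly-∈Span s with inSpecies? y y' s
    ... | yes s∈𝒮 = ∈Span-member (∈-map⁺ (ssPoly rate y y') (∈-filter⁺ (inSpecies? y y') (∈-allFin s) s∈𝒮))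
    ... | no  s∉𝒮 = ∈Span-resp-≈ (≋-sym (indexed-zero _ _ absent)) (0∈Span _)
      where
      absent : ∀ j → stoich y y' s j ≈ 0#
      absent j with y[j,s]≡0 , y'[j,s]≡0 ← notInSpecies s∉𝒮 j =
        trans (reflexive (≡.cong₂ (λ a b → natK b - natK a) y[j,s]≡0 y'[j,s]≡0)) (-‿inverseʳ 0#)

    ssGenerators-nonempty : ∀ j → y j ≢ zeroC → 0 ℕ.< length (ssGenerators K rate y y')
    ssGenerators-nonempty j y[j]≢0 with FinP.¬∀⟶∃¬ n _ (λ s → lookup (y j) s ℕP.≟ 0) (y[j]≢0 ∘ allZero)
      where
      allZero : ∀ {k} {w : Vec ℕ k} → (∀ s → lookup w s ≡ 0) → w ≡ Vec.replicate k 0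
      allZero {w = []}    _  = ≡.refl
      allZero {w = x ∷ w} ≡0 = ≡.cong₂ _∷_ (≡0 Fin.zero) (allZero (≡0 ∘ Fin.suc))
    ... | s , y[j,s]≢0 =
      ≡.subst (0 ℕ.<_) (≡.sym (ListP.length-map (ssPoly rate y y') (List.filter (inSpecies? y y') (allFin n))))
      (ListP.filter-some (inSpecies? y y') (Any.map (λ { ≡.refl → j , inj₁ y[j,s]≢0 }) (∈-allFin s)))

module BalancedWeights {c ℓ} (K : CommutativeRing c ℓ)
  {n m : ℕ} (y y' : Fin m → Complex n) (zeroOne : IsZeroOne y y')
  (ℰr ℰb : Multiset n m) (i : Fin m) (balanced : AlmostBalanced y y' ℰr ℰb (u i))
  (k : Fin n) (ℰ[k]≡0 : (ℰr ⊔ᴹ ℰb) (sp k) ≡ 0) where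

  open CommutativeRing K using (Carrier; _≈_; _*_; _-_; -_; 0#)
  private module Kᵣ = CommutativeRing K
  open Defs using (Vertex; v; degree)
  open Defs.FieldDefs K using (natK)
  open ListSums K using (∑; ∑-cong; ∑-+; ∑-neg)
  open IntegerRingSolver K using (solve; _:=_; _:+_; _:-_; :-_; _:*_)
  open StoichiometricCombinations K using (stoich; degree-v-u; natK-+)
  open import Relation.Binary.Reasoning.Setoid Kᵣ.setoid

  y'' : Fin m → Complex n
  y'' = modifyProduct y' i k

  excess : ℕ
  excess = proj₁ (proj₁ balanced)

  weight : Fin n → Carrier
  weight s = natK (ℰr (sp s)) - natK (ℰb (sp s))

  imbalance : Vertex m → Carrier
  imbalance w = natK (degree y y' ℰr w) - natK (degree y y' ℰb w)

  imbalance-≢ : ∀ w → w ≢ u i → imbalance w ≈ 0#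
  imbalance-≢ w w≢uᵢ rewrite proj₂ balanced w w≢uᵢ = Kᵣ.-‿inverseʳ _

  imbalance-u : imbalance (u i) ≈ natK excess
  imbalance-u = begin
    natK (degree y y' ℰr (u i)) - natK d
      ≡⟨ ≡.cong (λ e → natK e - natK d) (proj₂ (proj₂ (proj₁ balanced))) ⟩
    natK (d ℕ.+ excess) - natK d                           ≈⟨ Kᵣ.+-congʳ (natK-+ d excess) ⟩
    natK d Kᵣ.+ natK excess - natK d
      ≈⟨ solve 2 (λ a b → a :+ b :- a := b) Kᵣ.refl (natK d) (natK excess) ⟩
    natK excess                                            ∎
    where d = degree y y' ℰb (u i)

  ∑weight·stoich : ∀ j → ∑ (allFin n) (λ s → weight s * stoich y y' s j) ≈ imbalance (v j) - imbalance (u j)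
  ∑weight·stoich j = begin
    ∑ (allFin n) (λ s → weight s * stoich y y' s j)
      ≈⟨ ∑-cong (allFin n) (λ s → solve 3 (λ r b w → (r :- b) :* w := r :* w :+ :- (b :* w)) Kᵣ.refl _ _ _) ⟩
    ∑ (allFin n) (λ s → natK (ℰr (sp s)) * stoich y y' s j Kᵣ.+ - (natK (ℰb (sp s)) * stoich y y' s j))
      ≈⟨ Kᵣ.trans (∑-+ (allFin n) _ _) (Kᵣ.+-congˡ (∑-neg (allFin n) _)) ⟩
    ∑ (allFin n) (λ s → natK (ℰr (sp s)) * stoich y y' s j) - ∑ (allFin n) (λ s → natK (ℰb (sp s)) * stoich y y' s j)
      ≈⟨ Kᵣ.+-cong (degree-v-u y y' zeroOne ℰr j) (Kᵣ.-‿cong (degree-v-u y y' zeroOne ℰb j)) ⟨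
    (dr (v j) - dr (u j)) - (db (v j) - db (u j))
      ≈⟨ solve 4 (λ a b d e → (a :- b) :- (d :- e) := (a :- d) :- (b :- e)) Kᵣ.refl _ _ _ _ ⟩
    imbalance (v j) - imbalance (u j) ∎
    where
    dr db : Vertex m → Carrier
    dr w = natK (degree y y' ℰr w)
    db w = natK (degree y y' ℰb w)

  ∑weight·stoich-≢ : ∀ j → j ≢ i → ∑ (allFin n) (λ s → weight s * stoich y y' s j) ≈ 0#
  ∑weight·stoich-≢ j j≢i = begin
    ∑ (allFin n) (λ s → weight s * stoich y y' s j) ≈⟨ ∑weight·stoich j ⟩
    imbalance (v j) - imbalance (u j)
      ≈⟨ Kᵣ.+-cong (imbalance-≢ (v j) (λ ())) (Kᵣ.-‿cong (imbalance-≢ (u j) (j≢i ∘ uInjective))) ⟩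
    0# - 0#                                    ≈⟨ Kᵣ.-‿inverseʳ 0# ⟩
    0#                                         ∎
    where
    uInjective : u j ≡ u i → j ≡ i
    uInjective ≡.refl = ≡.refl

  ∑weight·stoich-≡ : ∑ (allFin n) (λ s → weight s * stoich y y' s i) ≈ - natK excess
  ∑weight·stoich-≡ = begin
    ∑ (allFin n) (λ s → weight s * stoich y y' s i) ≈⟨ ∑weight·stoich i ⟩
    imbalance (v i) - imbalance (u i)          ≈⟨ Kᵣ.+-cong (imbalance-≢ (v i) (λ ())) (Kᵣ.-‿cong imbalance-u) ⟩
    0# - natK excess                           ≈⟨ Kᵣ.+-identityˡ _ ⟩
    - natK excess                              ∎

  weight[k]≈0 : weight k ≈ 0#
  weight[k]≈0 rewrite ℕP.m+n≡0⇒m≡0 (ℰr (sp k)) ℰ[k]≡0 | ℕP.m+n≡0⇒n≡0 (ℰr (sp k)) ℰ[k]≡0 = Kᵣ.-‿inverseʳ 0#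

  y''-≢ : ∀ j → j ≢ i → y'' j ≡ y' j
  y''-≢ j j≢i with j FinP.≟ i
  ... | yes j≡i = contradiction j≡i j≢i
  ... | no  _   = ≡.refl

  -- Only the coefficient of s_k in the i-th product changes, and weight k = 0.
  weight·stoich-y'' : ∀ s j → weight s * stoich y y'' s j ≈ weight s * stoich y y' s j
  weight·stoich-y'' s j with s FinP.≟ k | j FinP.≟ i
  ... | yes ≡.refl | _          = Kᵣ.trans (weight[k]*≈0 _) (Kᵣ.sym (weight[k]*≈0 _))
    where weight[k]*≈0 : ∀ a → weight k * a ≈ 0#
          weight[k]*≈0 a = Kᵣ.trans (Kᵣ.*-congʳ weight[k]≈0) (Kᵣ.zeroˡ a)
  ... | no  s≢k    | yes ≡.refl =
    Kᵣ.reflexive (≡.cong (λ e → weight s * (natK e - natK (lookup (y j) s))) (VecP.lookup∘updateAt′ s k s≢k (y' j)))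
  ... | no  _      | no  _      = Kᵣ.refl


module ProductModification {c ℓ} (K : CommutativeRing c ℓ) (FK : IsFieldChar0 K)
  {n m : ℕ} (y y' : Fin m → Complex n) (network : IsNetwork y y') (zeroOne : IsZeroOne y y')
  (ℰr ℰb : Multiset n m) (i : Fin m) (balanced : AlmostBalanced y y' ℰr ℰb (u i))
  (k : Fin n) (ℰ[k]≡0 : (ℰr ⊔ᴹ ℰb) (sp k) ≡ 0) where

  private module Kᵣ = CommutativeRing K
  open Defs.FieldDefs K using (natK)
  open Defs.PolyDefs K using (Vars; Poly; Monomial; InKappa; _⊆Ideal_)
  open Defs.SteadyState K using (ssPoly; unitVec)
  open BalancedWeights K y y' zeroOne ℰr ℰb i balanced k ℰ[k]≡0
  open ListSums K using () renaming (∑ to ∑ᴷ; ∑-cong to ∑ᴷ-cong)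
  open StoichiometricCombinations K using (stoich)
  open Polynomials K using (polynomialRing; _⊕_; ⊕-comm)
  open TermFamilies K using (single; const; indexed; single-cong; single-nonzero; single≋const*single;
                             single*single; indexed-onlyAt; indexed-exceptAt; ∑-const*-indexed)
  open SteadyStateGenerators K using (ssPoly-∈Span; ssGenerators-nonempty)
  open NonzeroProducts K FK using (*P-nonzero)
  open RationalCombinations K FK using (InKappa-*; ⊆Ideal-fromSpan)
  open import Data.Fin using (inject₁; fromℕ; _↑ʳ_)
  import Data.List.Relation.Unary.All.Properties as AllP

  private V = Vars m n
  open CommutativeRing (polynomialRing V)
  open ListSums (polynomialRing V) using (∑)
  open LinearCombinations (polynomialRing V) using (_∈Span_; ∈Span-∑; ∈Span-*ˡ; ∈Span-exchange)
  open IntegerRingSolver (polynomialRing V) using (solve; _:=_; _:+_; _:-_)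
  open import Algebra.Properties.Ring ring using (-‿distribˡ-*)
  open import Relation.Binary.Reasoning.Setoid setoid

  rate rate' : Fin m → Fin (suc m)
  rate  = rateN K
  rate' = rateN' K i

  reactant : (Fin m → Fin (suc m)) → Fin m → Monomial V
  reactant r j = unitVec (r j) Vec.++ y j

  κ : Fin (suc m) → Poly V
  κ r = single Kᵣ.1# (unitVec r Vec.++ Vec.replicate n 0)

  κxʸ κ'xʸ : Poly V
  κxʸ  = single Kᵣ.1# (reactant rate i)
  κ'xʸ = single Kᵣ.1# (reactant rate' i)

  k·κ : Fin (suc m) → Poly V
  k·κ r = const (natK excess) * κ r

  rate'-≢ : ∀ j → j ≢ i → rate' j ≡ inject₁ j
  rate'-≢ j j≢i with j FinP.≟ i
  ... | yes j≡i = contradiction j≡i j≢i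
  ... | no  _   = ≡.refl

  rate'-≡ : rate' i ≡ fromℕ m
  rate'-≡ with i FinP.≟ i
  ... | yes _   = ≡.refl
  ... | no  i≢i = contradiction ≡.refl i≢i

  κ·κ'xʸ≈κ'·κxʸ : κ (inject₁ i) * κ'xʸ ≈ κ (fromℕ m) * κxʸ
  κ·κ'xʸ≈κ'·κxʸ = trans (single*single Kᵣ.1# Kᵣ.1# _ (reactant rate' i))
                 (trans (reflexive (≡.cong (single (Kᵣ.1# Kᵣ.* Kᵣ.1#)) monomials))
                        (sym (single*single Kᵣ.1# Kᵣ.1# _ (reactant rate i))))
    where
    monomials : (unitVec (inject₁ i) Vec.++ Vec.replicate n 0) ⊕ reactant rate' i
              ≡ (unitVec (fromℕ m) Vec.++ Vec.replicate n 0) ⊕ reactant rate i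
    monomials = ≡.trans (VecP.zipWith-++ ℕ._+_ (unitVec (inject₁ i)) o (unitVec (rate' i)) (y i))
      (≡.trans (≡.cong (Vec._++ o ⊕ y i) swapUnits)
               (≡.sym (VecP.zipWith-++ ℕ._+_ (unitVec (fromℕ m)) o (unitVec (inject₁ i)) (y i))))
      where
      swapUnits : unitVec (inject₁ i) ⊕ unitVec (rate' i) ≡ unitVec (fromℕ m) ⊕ unitVec (inject₁ i)
      o = Vec.replicate n 0
      swapUnits rewrite rate'-≡ = ⊕-comm (unitVec (inject₁ i)) (unitVec (fromℕ m))

  module _ (r : Fin m → Fin (suc m)) (y₂ : Fin m → Complex n)
           (agrees : ∀ s j → weight s Kᵣ.* stoich y y₂ s j Kᵣ.≈ weight s Kᵣ.* stoich y y' s j) where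

    ∑weight·ssPoly : ∑ (allFin n) (λ s → const (weight s) * ssPoly r y y₂ s)
                   ≈ - (const (natK excess) * single Kᵣ.1# (reactant r i))
    ∑weight·ssPoly = begin
      ∑ (allFin n) (λ s → const (weight s) * ssPoly r y y₂ s)
        ≈⟨ ∑-const*-indexed (allFin n) weight (stoich y y₂) (reactant r) ⟩
      indexed (λ j → ∑ᴷ (allFin n) (λ s → weight s Kᵣ.* stoich y y₂ s j)) (reactant r)
        ≈⟨ indexed-onlyAt i _ (reactant r) (λ j j≢i → Kᵣ.trans (∑ᴷ-cong (allFin n) (λ s → agrees s j)) (∑weight·stoich-≢ j j≢i)) ⟩
      single (∑ᴷ (allFin n) (λ s → weight s Kᵣ.* stoich y y₂ s i)) (reactant r i)
        ≈⟨ single-cong (reactant r i) (Kᵣ.trans (∑ᴷ-cong (allFin n) (λ s → agrees s i)) ∑weight·stoich-≡) ⟩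
      single (Kᵣ.- natK excess) (reactant r i)
        ≈⟨ single≋const*single (Kᵣ.- natK excess) (reactant r i) ⟩
      - const (natK excess) * single Kᵣ.1# (reactant r i)
        ≈⟨ -‿distribˡ-* (const (natK excess)) (single Kᵣ.1# (reactant r i)) ⟨
      - (const (natK excess) * single Kᵣ.1# (reactant r i)) ∎

    ∑weight·ssPoly-∈Span : ∑ (allFin n) (λ s → const (weight s) * ssPoly r y y₂ s) ∈Span ssGenerators K r y y₂
    ∑weight·ssPoly-∈Span = ∈Span-∑ (allFin n) _ (λ s → ∈Span-*ˡ (const (weight s)) (ssPoly-∈Span r y y₂ s))

  ssPoly-traded : ∀ s → ssPoly rate' y y'' s
                        ≈ ssPoly rate y y' s + (const (stoich y y'' s i) * κ'xʸ - const (stoich y y' s i) * κxʸ)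
  ssPoly-traded s = trans
    (indexed-exceptAt i (stoich y y'' s) (stoich y y' s) (reactant rate') (reactant rate) agree)
    (+-congˡ {ssPoly rate y y' s} (+-cong (single≋const*single (stoich y y'' s i) (reactant rate' i))
                                          (-‿cong (single≋const*single (stoich y y' s i) (reactant rate i)))))
    where
    agree : ∀ j → j ≢ i → stoich y y'' s j Kᵣ.≈ stoich y y' s j × reactant rate' j ≡ reactant rate j
    agree j j≢i = Kᵣ.reflexive (≡.cong (λ z → natK (lookup z s) Kᵣ.- natK (lookup (y j) s)) (y''-≢ j j≢i))
                , ≡.cong (λ r → unitVec r Vec.++ y j) (rate'-≢ j j≢i)

  ssPoly-traded⁻¹ : ∀ s → ssPoly rate y y' s
                          ≈ ssPoly rate' y y'' s + (const (stoich y y' s i) * κxʸ - const (stoich y y'' s i) * κ'xʸ)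
  ssPoly-traded⁻¹ s = begin
    X                      ≈⟨ solve 3 (λ X A B → X := X :+ (B :- A) :+ (A :- B)) refl X A B ⟩
    X + (B - A) + (A - B)  ≈⟨ +-congʳ (ssPoly-traded s) ⟨
    X' + (A - B)           ∎
    where
    X  = ssPoly rate y y' s
    X' = ssPoly rate' y y'' s
    A  = const (stoich y y' s i) * κxʸ
    B  = const (stoich y y'' s i) * κ'xʸ

  N'-times-κᵢ : ∀ s → ssPoly rate' y y'' s * k·κ (inject₁ i) ∈Span ssGenerators K rate y y'
  N'-times-κᵢ s = ∈Span-exchange (ssPoly rate y y' s) (ssPoly rate' y y'' s) κxʸ κ'xʸ
    (const (stoich y y' s i)) (const (stoich y y'' s i)) (κ (inject₁ i)) (κ (fromℕ m)) (const (natK excess))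
    (∑ (allFin n) (λ s → const (weight s) * ssPoly rate y y' s))
    (ssPoly-traded s) κ·κ'xʸ≈κ'·κxʸ (∑weight·ssPoly rate y' (λ _ _ → Kᵣ.refl))
    (ssPoly-∈Span rate y y' s) (∑weight·ssPoly-∈Span rate y' (λ _ _ → Kᵣ.refl))

  N-times-κᵢ' : ∀ s → ssPoly rate y y' s * k·κ (fromℕ m) ∈Span ssGenerators K rate' y y''
  N-times-κᵢ' s = ∈Span-exchange (ssPoly rate' y y'' s) (ssPoly rate y y' s) κ'xʸ κxʸ
    (const (stoich y y'' s i)) (const (stoich y y' s i)) (κ (fromℕ m)) (κ (inject₁ i)) (const (natK excess))
    (∑ (allFin n) (λ s → const (weight s) * ssPoly rate' y y'' s))
    (ssPoly-traded⁻¹ s) (sym κ·κ'xʸ≈κ'·κxʸ) (∑weight·ssPoly rate' y'' weight·stoich-y'')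
    (ssPoly-∈Span rate' y y'' s) (∑weight·ssPoly-∈Span rate' y'' weight·stoich-y'')

  k·κ-InKappa : ∀ r → InKappa m n (k·κ r)
  k·κ-InKappa r = InKappa-* (const (natK excess)) (κ r) (constant ∷ []) (rateOnly ∷ [])
    where
    constant : ∀ s → lookup (Vec.replicate (Vars m n) 0) (suc m ↑ʳ s) ≡ 0
    constant s = VecP.lookup-replicate (suc m ↑ʳ s) 0
    rateOnly : ∀ s → lookup (unitVec r Vec.++ Vec.replicate n 0) (suc m ↑ʳ s) ≡ 0
    rateOnly s = ≡.trans (VecP.lookup-++ʳ (unitVec r) _ s) (VecP.lookup-replicate s 0)

  k·κ-nonzero : ∀ r → ¬ k·κ r ≈ 0#
  k·κ-nonzero r = *P-nonzero (const (natK excess)) (κ r)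
    (single-nonzero (Vec.replicate (Vars m n) 0) (excess≉0 (proj₁ (proj₂ (proj₁ balanced)))))
    (single-nonzero (unitVec r Vec.++ Vec.replicate n 0) (IsFieldChar0.one≉zero FK))
    where
    excess≉0 : 0 ℕ.< excess → ¬ natK excess Kᵣ.≈ Kᵣ.0#
    excess≉0 (s≤s {n = e} _) = IsFieldChar0.char0 FK e

  N'⊆N : _⊆Ideal_ {m} {n} (ssGenerators K rate' y y'') (ssGenerators K rate y y')
  N'⊆N = ⊆Ideal-fromSpan _ _ (k·κ (inject₁ i)) (k·κ-InKappa (inject₁ i)) (k·κ-nonzero (inject₁ i))
    (ssGenerators-nonempty rate y y' i (IsNetwork.noInflow network i))
    (AllP.map⁺ (All.universal N'-times-κᵢ _))

  N⊆N' : _⊆Ideal_ {m} {n} (ssGenerators K rate y y') (ssGenerators K rate' y y'')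
  N⊆N' = ⊆Ideal-fromSpan _ _ (k·κ (fromℕ m)) (k·κ-InKappa (fromℕ m)) (k·κ-nonzero (fromℕ m))
    (ssGenerators-nonempty rate' y y'' i (IsNetwork.noInflow network i))
    (AllP.map⁺ (All.universal N-times-κᵢ' _))

theorem4p2 : ∀ {c ℓ : Level} (K : CommutativeRing c ℓ) → IsFieldChar0 K →
    ∀ {n m : ℕ} (y y' : Fin m → Complex n) →
    IsNetwork y y' → IsZeroOne y y' →
    (ℰr ℰb : Multiset n m) →
    IsMultisetOverEdges y y' (ℰr ⊔ᴹ ℰb) →
    (i : Fin m) → AlmostBalanced y y' ℰr ℰb (u i) →
    (k : Fin n) → lookup (y' i) k ≡ 0 →
    IsNetwork y (modifyProduct y' i k) →
    (ℰr ⊔ᴹ ℰb) (sp k) ≡ 0 →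
    _≡Ideal_ K {m} {n} (ssGenerators K (rateN' K i) y (modifyProduct y' i k))
    (ssGenerators K (rateN K) y y')
theorem4p2 K FK y y' network zeroOne ℰr ℰb _ i balanced k _ _ ℰ[k]≡0 = N'⊆N , N⊆N'
  where open ProductModification K FK y y' network zeroOne ℰr ℰb i balanced k ℰ[k]≡0
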